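{- Let $G=(V,E)$ be a bridgeless cubic graph and let $V=A\cup B$ be a flow partition of $G$ with respect to a 2-factor $\mathcal{F}_2$ (as described in the context). Let $F$ be a connected subgraph of $\mathcal{F}_2$, and let $a_F$ and $b_F$ denote the numbers of vertices of $F$ lying in $A$ and in $B$, respectively. Then: (1) if $F$ is an even cycle, $b_F=a_F$; (2) if $F$ is an odd cycle, $b_F\le a_F+1$; (3) if $F$ is a path, $b_F\le a_F+3$.
   Context: Graphs may have multiple edges but no loops. A flow on a graph $M$ is a pair $(D,\varphi)$ where $D$ is an orientation and $\varphi$ a nonnegative integer function on edges with inflow equal to outflow at each vertex. For flows $(D_1,\varphi_1)$ on $M[E_1]$ and $(D_2,\varphi_2)$ on $M[E_2]$ (extended by $0$ outside their edge sets), the sum is the flow $(D,\varphi)$ on $M[E_1\cup E_2]$ where $D$ agrees with $D_1$ on edges with $\varphi_1(e)\ge\varphi_2(e)$ and with $D_2$ on edges with $\varphi_2(e)>\varphi_1(e)$, and $\varphi(e)=\varphi_1(e)+\varphi_2(e)$ if $e$ has the same direction in $D_1$ and $D_2$, and $\varphi(e)=|\varphi_1(e)-\varphi_2(e)|$ otherwise; sums of several flows are formed iteratively. Flow partition: Let $G=(V,E)$ be a bridgeless cubic graph and $\mathcal{F}_2$ a 2-factor of $G$ with odd cycles $C_1,\dots,C_{2t}$ and even cycles $C_{2t+1},\dots,C_{2t+\ell}$ ($t,\ell\ge 0$). A canonical 4-coloring $c$ (w.r.t. $\mathcal{F}_2$) colors the edges of the complementary 1-factor with $1$, the edges of each even cycle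 alternately with $2$ and $3$, and the edges of each odd cycle alternately with $2$ and $3$ except for exactly one edge colored $0$. Then there are exactly $2t$ vertices $z_1,\dots,z_{2t}$ at which color $2$ is missing. Let $M_G$ be obtained from $G$ by adding two edges $f_i,f_i'$ between $z_{2i-1}$ and $z_{2i}$ for $i=1,\dots,t$; extend $c$ by coloring $f_i'$ with $2$ and $f_i$ with $4$. Let $C_1',\dots,C_s'$ be the cycles of the 2-factor of $M_G$ formed by edges colored $1$ and $2$, and $C_i''$ the 2-cycle formed by $f_i,f_i'$. Let $(D_i,\varphi_i)$ be a flow on $C_i$ ($1\le i\le 2t+\ell$) directing it as a directed cycle with value $2$ on each edge; $(D_i',\varphi_i')$ a flow on $C_i'$ directing it as a directed cycle with value $1$ on each edge; $(D_i'',\varphi_i'')$ a flow on $C_i''$ directing it as a directed cycle with value $1$ on $f_i,f_i'$, where $f_i'$ receives the same direction as in the flow on the cycle $C_j'$ containing it. Let $(D,\varphi)$ be the sum of all these flows; it is a nowhere-zero 4-flow on $M_G$. Define $w'(v)=2(2d^+_{D}(v)-d_{M_G}(v))$, where $d^+_D(v)$ is the outdegree of $v$ in $D$ and $d_{M_G}(v)$ is the degree of $v$ in $M_G$; by the construction $w'(v)\in\{\pm 2\}$ for all $v$. Set $A=\{v: w'(v)=-2\}$ (white vertices) and $B=\{v:w'(v)=2\}$ (black vertices). Any partition $V=A\cup B$ arising this way (for some choice of $\mathcal{F}_2$, $c$ and the cycle orientations) is called a flow partition of $G$ with respect to $\mathcal{F}_2$. A connected subgraph of $\mathcal{F}_2$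 is thus either a cycle of $\mathcal{F}_2$ or a path contained in a cycle of $\mathcal{F}_2$. -}

module Defs where

open import Data.Nat as ℕ using (ℕ; zero; suc; _+_; _*_; _≤_; _<_; _≡ᵇ_; _≤ᵇ_; ∣_-_∣)
open import Data.Integer as ℤ using (ℤ; _⊖_)
open import Data.Fin using (Fin; zero; suc; _↑ˡ_; _↑ʳ_; splitAt)
import Data.Fin as Fin
open import Data.Bool as Bool using (Bool; true; false; _∧_; _∨_; not; if_then_else_)
open import Data.Sum using (_⊎_; inj₁; inj₂; [_,_])
open import Data.Product using (Σ; ∃; _×_; _,_)
open import Data.List using (List; []; _∷_; _++_; foldl)
open import Data.List.Relation.Unary.Unique.Propositional using (Unique)
open import Data.List.Relation.Unary.Linked using (Linked)
open import Data.Vec.Functional using (toList)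
open import Function using (_∘_; const)
open import Relation.Nullary.Decidable using (⌊_⌋)
open import Relation.Binary.PropositionalEquality using (_≡_; _≢_)

count : ∀ {k} → (Fin k → Bool) → ℕ
count {zero}  P = 0
count {suc k} P = (if P zero then 1 else 0) + count (λ i → P (suc i))

countL : ∀ {A : Set} → (A → Bool) → List A → ℕ
countL P []       = 0
countL P (x ∷ xs) = (if P x then 1 else 0) + countL P xs

Even : ℕ → Set
Even n = ∃ λ k → n ≡ 2 * k

Odd : ℕ → Set
Odd n = ∃ λ k → n ≡ suc (2 * k)

-- Multigraphs: vertices Fin nV, edges Fin nE; edge e joins src e and tgt e
-- (src/tgt is only a reference orientation; edges are undirected).
-- Multiple edges are allowed; loops are excluded by the predicate Loopless.

record Graph : Set where
  field
    nV nE : ℕ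
    src tgt : Fin nE → Fin nV

module _ (G : Graph) where
  open Graph G

  Loopless : Set
  Loopless = ∀ e → src e ≢ tgt e

  EdgeSet : Set
  EdgeSet = Fin nE → Bool

  VertexSet : Set
  VertexSet = Fin nV → Bool

  incident : Fin nV → Fin nE → Bool
  incident v e = ⌊ src e Fin.≟ v ⌋ ∨ ⌊ tgt e Fin.≟ v ⌋

  deg : EdgeSet → Fin nV → ℕ
  deg S v = count (λ e → S e ∧ incident v e)

  allEdges : EdgeSet
  allEdges = λ _ → true

  data Reach (S : EdgeSet) : Fin nV → Fin nV → Set where
    here : ∀ {v} → Reach S v v
    fwd  : ∀ {e w} → S e ≡ true → Reach S (tgt e) w → Reach S (src e) w
    bwd  : ∀ {e w} → S e ≡ true → Reach S (src e) w → Reach S (tgt e) w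

  Cubic : Set
  Cubic = ∀ v → deg allEdges v ≡ 3

  Bridgeless : Set
  Bridgeless = ∀ e → Reach (λ e' → not ⌊ e' Fin.≟ e ⌋) (src e) (tgt e)

  TwoFactor : EdgeSet → Set
  TwoFactor S = ∀ v → deg S v ≡ 2

  -- K is (the edge set of) a connected component of the spanning
  -- subgraph (V , S); for a 2-factor S these are exactly its cycles.
  ComponentOf : EdgeSet → EdgeSet → Set
  ComponentOf S K = ∃ λ v → ∀ e →
    (K e ≡ true → S e ≡ true × Reach S v (src e)) ×
    (S e ≡ true × Reach S v (src e) → K e ≡ true)

  CycleOf : EdgeSet → EdgeSet → Set
  CycleOf = ComponentOf

  EnumComponents : EdgeSet → (k : ℕ) → (Fin k → EdgeSet) → Set
  EnumComponents S k Cs =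
    (∀ i → ComponentOf S (Cs i)) ×
    (∀ e → S e ≡ true → ∃ λ i → Cs i e ≡ true) ×
    (∀ i j e → Cs i e ≡ true → Cs j e ≡ true → i ≡ j)

  onK : EdgeSet → Fin nV → Bool
  onK K v = not (deg K v ≡ᵇ 0)

  Adj : EdgeSet → Fin nV → Fin nV → Set
  Adj S u v = ∃ λ e → S e ≡ true ×
    ((src e ≡ u × tgt e ≡ v) ⊎ (src e ≡ v × tgt e ≡ u))

  IsPath : EdgeSet → List (Fin nV) → Set
  IsPath S vs = Unique vs × Linked (Adj S) vs

-- Flows: an orientation (dir e = true means src e → tgt e) and a value.

record Flow (m : ℕ) : Set where
  field
    dir : Fin m → Bool
    val : Fin m → ℕ
open Flow public

_⊕_ : ∀ {m} → Flow m → Flow m → Flow m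
F₁ ⊕ F₂ = record
  { dir = λ e → if val F₂ e ≤ᵇ val F₁ e then dir F₁ e else dir F₂ e
  ; val = λ e → if ⌊ dir F₁ e Bool.≟ dir F₂ e ⌋
                then val F₁ e + val F₂ e
                else ∣ val F₁ e - val F₂ e ∣
  }

zeroFlow : ∀ {m} → Flow m
zeroFlow = record { dir = λ _ → true ; val = λ _ → 0 }

sumFlows : ∀ {m} → List (Flow m) → Flow m
sumFlows = foldl _⊕_ zeroFlow

module _ (G : Graph) where
  open Graph G

  tail : Flow nE → Fin nE → Fin nV
  tail F e = if dir F e then src e else tgt e

  outdeg : EdgeSet G → Flow nE → Fin nV → ℕ
  outdeg S F v = count (λ e → S e ∧ ⌊ tail F e Fin.≟ v ⌋)

  -- F is a flow on the subgraph G[K] directing it as a directed cycle,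
  -- with value k on each edge of K (and 0 outside K)
  DirCycleFlow : EdgeSet G → ℕ → Flow nE → Set
  DirCycleFlow K k F =
    (∀ e → K e ≡ true → val F e ≡ k) ×
    (∀ e → K e ≡ false → val F e ≡ 0) ×
    (∀ v → 0 < deg G K v → outdeg K F v ≡ 1)

  weight : Flow nE → Fin nV → ℤ
  weight F v = ℤ.+ 2 ℤ.* ((2 * outdeg (allEdges G) F v) ⊖ deg G (allEdges G) v)

module _ (G : Graph) where
  open Graph G

  Canonical : EdgeSet G → (Fin nE → ℕ) → Set
  Canonical F2 c =
    (∀ e → F2 e ≡ false → c e ≡ 1) ×
    (∀ e → F2 e ≡ true → c e ≡ 0 ⊎ c e ≡ 2 ⊎ c e ≡ 3) ×
    (∀ e e' → e ≢ e' → (∃ λ v → incident G v e ≡ true × incident G v e' ≡ true)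
            → c e ≢ c e') ×
    (∀ K → CycleOf G F2 K →
       (Even (count K) → count (λ e → K e ∧ (c e ≡ᵇ 0)) ≡ 0) ×
       (Odd  (count K) → count (λ e → K e ∧ (c e ≡ᵇ 0)) ≡ 1))

  Missing2 : (Fin nE → ℕ) → Fin nV → Set
  Missing2 c v = ∀ e → incident G v e ≡ true → c e ≢ 2

  -- M_G: edges of G, then f'_i (i < t), then f_i (i < t); both f'_i and f_i
  -- join z(inj₁ i) = z_{2i-1} and z(inj₂ i) = z_{2i}.
  MG : (t : ℕ) → (Fin t ⊎ Fin t → Fin nV) → Graph
  MG t z = record
    { nV = nV
    ; nE = nE + (t + t)
    ; src = [ src , [ (λ i → z (inj₁ i)) , (λ i → z (inj₁ i)) ] ∘ splitAt t ] ∘ splitAt nE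
    ; tgt = [ tgt , [ (λ i → z (inj₂ i)) , (λ i → z (inj₂ i)) ] ∘ splitAt t ] ∘ splitAt nE
    }

  f' : ∀ {t} → Fin t → Fin (nE + (t + t))
  f' {t} i = nE ↑ʳ (i ↑ˡ t)

  f : ∀ {t} → Fin t → Fin (nE + (t + t))
  f {t} i = nE ↑ʳ (t ↑ʳ i)

  cM : ∀ t → (Fin nE → ℕ) → Fin (nE + (t + t)) → ℕ
  cM t c = [ c , [ const 2 , const 4 ] ∘ splitAt t ] ∘ splitAt nE

  liftE : ∀ t → EdgeSet G → Fin (nE + (t + t)) → Bool
  liftE t K = [ K , const false ] ∘ splitAt nE

  pairSet : ∀ t → Fin t → Fin (nE + (t + t)) → Bool
  pairSet t i e = ⌊ e Fin.≟ f' i ⌋ ∨ ⌊ e Fin.≟ f i ⌋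

  -- all data witnessing that `black` (B = black, A = white) is a flow
  -- partition of G with respect to F2
  record FlowPartition (F2 : EdgeSet G) (black : Fin nV → Bool) : Set where
    field
      c      : Fin nE → ℕ
      canon  : Canonical F2 c
      t      : ℕ
      z      : Fin t ⊎ Fin t → Fin nV
      z-inj  : ∀ x y → z x ≡ z y → x ≡ y
      z-miss : ∀ x → Missing2 c (z x)
      z-onto : ∀ v → Missing2 c v → ∃ λ x → z x ≡ v
      k      : ℕ
      C      : Fin k → EdgeSet G
      C-enum : EnumComponents G F2 k C
      fl     : Fin k → Flow (nE + (t + t))
      fl-ok  : ∀ i → DirCycleFlow (MG t z) (liftE t (C i)) 2 (fl i)
      s      : ℕ
      C'     : Fin s → EdgeSet (MG t z)
      C'-enum : EnumComponents (MG t z)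
                  (λ e → (cM t c e ≡ᵇ 1) ∨ (cM t c e ≡ᵇ 2)) s C'
      fl'    : Fin s → Flow (nE + (t + t))
      fl'-ok : ∀ j → DirCycleFlow (MG t z) (C' j) 1 (fl' j)
      fl''   : Fin t → Flow (nE + (t + t))
      fl''-ok : ∀ i → DirCycleFlow (MG t z) (pairSet t i) 1 (fl'' i)
      fl''-compat : ∀ i j → C' j (f' i) ≡ true → dir (fl'' i) (f' i) ≡ dir (fl' j) (f' i)
      partition : ∀ v →
        (black v ≡ true  → weight (MG t z)
            (sumFlows (toList fl ++ toList fl' ++ toList fl'')) v ≡ ℤ.+ 2) ×
        (black v ≡ false → weight (MG t z)
            (sumFlows (toList fl ++ toList fl' ++ toList fl'')) v ≡ ℤ.- (ℤ.+ 2))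

  aCyc bCyc : (Fin nV → Bool) → EdgeSet G → ℕ
  aCyc black K = count (λ v → onK G K v ∧ not (black v))
  bCyc black K = count (λ v → onK G K v ∧ black v)

  aPath bPath : (Fin nV → Bool) → List (Fin nV) → ℕ
  aPath black vs = countL (λ v → not (black v)) vs
  bPath black vs = countL black vs

-- Let e be an edge of the 2-factor coloured 2. Its ends u are not among the z_i, so in M_G they
-- keep degree 3: the two 2-factor edges, oriented by the value-2 flow on their cycle (one leaves u),
-- and the colour-1 edge, oriented by the value-1 flow on the (1,2)-cycle through e. Hence u is black
-- (outdegree 2) iff that (1,2)-cycle leaves u along its colour-1 edge, i.e. not along e; since it
-- leaves exactly one end of e along e, the ends of e get opposite colours. The colour-2 edges form
-- a matching, so in a vertex set containing the ends of some of them, black and white vertices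
-- covered by these edges are equinumerous and b ≤ a + #uncovered. On a cycle of the 2-factor every
-- uncovered vertex meets an edge coloured 0: there is none on an even cycle and, by parity, at most
-- one on an odd cycle. On a path, an uncovered interior vertex is also uncovered on its cycle, which
-- leaves at most 1 + 2 uncovered vertices.

module Submission where

open import Defs
import Data.Integer as ℤ
open import Data.Nat using (ℕ; zero; suc; _+_; _*_; _≤_; _<_; z≤n; s≤s; _≡ᵇ_; _≤ᵇ_; ∣_-_∣)
import Data.Nat.Properties as ℕ
open import Data.Nat.Properties
  using ( +-assoc; +-identityʳ; +-mono-≤; +-monoʳ-≤; +-cancelˡ-≡; +-cancelʳ-≤; m≤m+n; m≤n+m
        ; m+n≡0⇒m≡0; m+n≡0⇒n≡0; n≤0⇒n≡0; *-comm; *-suc; *-zeroʳ; *-identityʳ; *-distribˡ-+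
        ; *-cancelˡ-≡; ≤-refl; ≤-reflexive; ≤-trans; ≤⇒≤ᵇ; ≡ᵇ⇒≡; even≢odd; ∣-∣-identityʳ
        ; +-commutativeSemigroup; +-*-semiring; module ≤-Reasoning )
open import Data.Fin using (Fin; zero; suc; _↑ˡ_; _↑ʳ_; _≟_; splitAt)
open import Data.Fin.Properties using (suc-injective; 0≢1+n; splitAt-↑ˡ; splitAt-↑ʳ)
open import Data.Bool using (Bool; true; false; _∧_; _∨_; not; if_then_else_; T)
open import Data.Bool.Properties using (∧-conicalˡ; ∧-conicalʳ; ∧-zeroʳ; ∧-identityʳ; ∨-zeroʳ; ¬-not; not-¬)
open import Data.Product using (∃; _×_; _,_; proj₁; proj₂)
open import Data.Sum using (_⊎_; inj₁; inj₂)
open import Data.Empty using (⊥; ⊥-elim)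
open import Data.List using (List; []; _∷_; _++_; foldl; length)
open import Data.List.Properties using (foldl-++)
open import Data.List.Relation.Unary.All using (All; []; _∷_)
open import Data.List.Relation.Unary.Unique.Propositional using (Unique)
open import Data.List.Relation.Unary.AllPairs using ([]; _∷_)
open import Data.List.Relation.Unary.Linked using (Linked; _∷_)
open import Data.Vec.Functional using (toList)
open import Function using (_∘_)
open import Relation.Nullary using (Dec; yes; no)
open import Relation.Nullary.Decidable using (⌊_⌋)
open import Relation.Binary.PropositionalEquality
open import Algebra.Properties.CommutativeSemigroup +-commutativeSemigroup using (x∙yz≈y∙xz)
open import Algebra.Properties.Semiring.Sum +-*-semiring
  using (sum; sum-cong-≗; ∑-distrib-+; ∑-comm; *-distribˡ-sum; sum-replicate-zero)

-- Counting over finite sets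

𝟙 : Bool → ℕ
𝟙 b = if b then 1 else 0

count≡sum : ∀ {k} (P : Fin k → Bool) → count P ≡ sum (𝟙 ∘ P)
count≡sum {zero}  P = refl
count≡sum {suc k} P = cong (𝟙 (P zero) +_) (count≡sum (P ∘ suc))

sum-mono-≤ : ∀ {k} {f g : Fin k → ℕ} → (∀ i → f i ≤ g i) → sum f ≤ sum g
sum-mono-≤ {zero}  f≤g = z≤n
sum-mono-≤ {suc k} f≤g = +-mono-≤ (f≤g zero) (sum-mono-≤ (f≤g ∘ suc))

sum-zero : ∀ {k} (f : Fin k → ℕ) → (∀ i → f i ≡ 0) → sum f ≡ 0
sum-zero {k} f f≡0 = trans (sum-cong-≗ f≡0) (sum-replicate-zero k)

sum-single : ∀ {k} (f : Fin k → ℕ) (a : Fin k) → (∀ i → i ≢ a → f i ≡ 0) → sum f ≡ f a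
sum-single {suc k} f zero    h = trans (cong (f zero +_) (sum-zero _ (λ i → h (suc i) λ ()))) (+-identityʳ _)
sum-single {suc k} f (suc a) h = cong₂ _+_ (h zero λ ())
  (sum-single (f ∘ suc) a (λ i i≢a → h (suc i) (i≢a ∘ suc-injective)))

sum-δ : ∀ {k} (a : Fin k) (g : Fin k → ℕ) → sum (λ i → 𝟙 ⌊ a ≟ i ⌋ * g i) ≡ g a
sum-δ a g = trans (sum-single _ a off) on
  where
  off : ∀ i → i ≢ a → 𝟙 ⌊ a ≟ i ⌋ * g i ≡ 0
  off i i≢a with a ≟ i
  ... | yes a≡i = ⊥-elim (i≢a (sym a≡i))
  ... | no  _   = refl
  on : 𝟙 ⌊ a ≟ a ⌋ * g a ≡ g a
  on with a ≟ a
  ... | yes _   = +-identityʳ (g a)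
  ... | no  a≢a = ⊥-elim (a≢a refl)

count-↑ : ∀ {m n} (P : Fin (m + n) → Bool) → count P ≡ count (P ∘ (_↑ˡ n)) + count (P ∘ (m ↑ʳ_))
count-↑ {zero}      P = refl
count-↑ {suc m} {n} P = trans (cong (𝟙 (P zero) +_) (count-↑ {m} (P ∘ suc))) (sym (+-assoc (𝟙 (P zero)) _ _))

count-cong : ∀ {k} {P Q : Fin k → Bool} → (∀ i → P i ≡ Q i) → count P ≡ count Q
count-cong {zero}  P≗Q = refl
count-cong {suc k} P≗Q = cong₂ _+_ (cong 𝟙 (P≗Q zero)) (count-cong (P≗Q ∘ suc))

count-mono : ∀ {k} {P Q : Fin k → Bool} → (∀ i → P i ≡ true → Q i ≡ true) → count P ≤ count Q
count-mono {P = P} {Q} P⊆Q = subst₂ _≤_ (sym (count≡sum P)) (sym (count≡sum Q)) (sum-mono-≤ pointwise)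
  where
  pointwise : ∀ i → 𝟙 (P i) ≤ 𝟙 (Q i)
  pointwise i with P i in Pi
  ... | false = z≤n
  ... | true rewrite P⊆Q i Pi = ≤-refl

count-∨ : ∀ {k} (P Q : Fin k → Bool) → count (λ i → P i ∨ Q i) ≤ count P + count Q
count-∨ P Q = begin
  count (λ i → P i ∨ Q i)
    ≡⟨ count≡sum (λ i → P i ∨ Q i) ⟩
  sum (λ i → 𝟙 (P i ∨ Q i))
    ≤⟨ sum-mono-≤ (λ i → 𝟙-∨ (P i) (Q i)) ⟩
  sum (λ i → 𝟙 (P i) + 𝟙 (Q i))
    ≡⟨ ∑-distrib-+ (𝟙 ∘ P) (𝟙 ∘ Q) ⟩
  sum (𝟙 ∘ P) + sum (𝟙 ∘ Q)
    ≡⟨ sym (cong₂ _+_ (count≡sum P) (count≡sum Q)) ⟩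
  count P + count Q ∎
  where
  open ≤-Reasoning
  𝟙-∨ : ∀ p q → 𝟙 (p ∨ q) ≤ 𝟙 p + 𝟙 q
  𝟙-∨ true  _ = s≤s z≤n
  𝟙-∨ false _ = ≤-refl

count-pos : ∀ {k} (P : Fin k → Bool) i → P i ≡ true → 0 < count P
count-pos {suc k} P zero    Pi rewrite Pi = s≤s z≤n
count-pos {suc k} P (suc i) Pi = ≤-trans (count-pos (P ∘ suc) i Pi) (m≤n+m _ (𝟙 (P zero)))

count-witness : ∀ {k} (P : Fin k → Bool) → 0 < count P → ∃ λ i → P i ≡ true
count-witness {suc k} P pos with P zero in P0
... | true  = zero , P0
... | false = let i , Pi = count-witness (P ∘ suc) pos in suc i , Pi

count-none : ∀ {k} (P : Fin k → Bool) → (∀ i → P i ≡ false) → count P ≡ 0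
count-none {k} P none = trans (count≡sum P) (sum-zero (𝟙 ∘ P) (λ i → cong 𝟙 (none i)))

count-supported : ∀ {k} (P : Fin k → Bool) a → (∀ i → P i ≡ true → i ≡ a) → count P ≡ 𝟙 (P a)
count-supported P a only-a = trans (count≡sum P) (sum-single (𝟙 ∘ P) a off-a)
  where
  off-a : ∀ i → i ≢ a → 𝟙 (P i) ≡ 0
  off-a i i≢a with P i in Pi
  ... | true  = ⊥-elim (i≢a (only-a i Pi))
  ... | false = refl

count-≤1 : ∀ {k} (P : Fin k → Bool) → (∀ i j → P i ≡ true → P j ≡ true → i ≡ j) → count P ≤ 1
count-≤1 {zero}  P unique = z≤n
count-≤1 {suc k} P unique with P zero in P0
... | false = count-≤1 (P ∘ suc) λ i j Pi Pj → suc-injective (unique (suc i) (suc j) Pi Pj)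
... | true  = s≤s (≤-reflexive (count-none (P ∘ suc) none))
  where
  none : ∀ i → P (suc i) ≡ false
  none i with P (suc i) in Pi
  ... | true  = ⊥-elim (0≢1+n (unique zero (suc i) P0 Pi))
  ... | false = refl

count-split : ∀ {k} (Q P : Fin k → Bool) →
  count P ≡ count (λ i → Q i ∧ P i) + count (λ i → not (Q i) ∧ P i)
count-split {zero}  Q P = refl
count-split {suc k} Q P with Q zero
... | true  = trans (cong (𝟙 (P zero) +_) (count-split (Q ∘ suc) (P ∘ suc))) (sym (+-assoc (𝟙 (P zero)) _ _))
... | false = trans (cong (𝟙 (P zero) +_) (count-split (Q ∘ suc) (P ∘ suc))) 
                  (x∙yz≈y∙xz (𝟙 (P zero)) (count (λ i → Q (suc i) ∧ P (suc i))) _)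

𝟙-∧ : ∀ a b → 𝟙 (a ∧ b) ≡ 𝟙 a * 𝟙 b
𝟙-∧ true  b = sym (+-identityʳ (𝟙 b))
𝟙-∧ false b = refl

count-δ : ∀ {k} (a : Fin k) (P : Fin k → Bool) → count (λ i → ⌊ a ≟ i ⌋ ∧ P i) ≡ 𝟙 (P a)
count-δ a P = trans (count≡sum (λ i → ⌊ a ≟ i ⌋ ∧ P i))
                    (trans (sum-cong-≗ (λ i → 𝟙-∧ ⌊ a ≟ i ⌋ (P i))) (sum-δ a (𝟙 ∘ P)))

count-≟ : ∀ {k} (a : Fin k) → count (λ i → ⌊ a ≟ i ⌋) ≡ 1
count-≟ a = trans (count-cong (λ i → sym (∧-identityʳ ⌊ a ≟ i ⌋))) (count-δ a (λ _ → true))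

⌊⌋-witness : ∀ {P : Set} {d : Dec P} → ⌊ d ⌋ ≡ true → P
⌊⌋-witness {d = yes p} _ = p

≡ᵇ-true⇒≡ : ∀ {m n} → (m ≡ᵇ n) ≡ true → m ≡ n
≡ᵇ-true⇒≡ {m} {n} eq = ≡ᵇ⇒≡ m n (subst T (sym eq) _)

infix 7 _∈ᵇ_
_∈ᵇ_ : ∀ {k} → Fin k → List (Fin k) → Bool
i ∈ᵇ []       = false
i ∈ᵇ (x ∷ xs) = ⌊ x ≟ i ⌋ ∨ i ∈ᵇ xs

∉⇒∈ᵇ≡false : ∀ {k} {i : Fin k} xs → All (i ≢_) xs → i ∈ᵇ xs ≡ false
∉⇒∈ᵇ≡false []       []           = refl
∉⇒∈ᵇ≡false {i = i} (x ∷ xs) (i≢x ∷ i∉xs) with x ≟ i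
... | yes x≡i = ⊥-elim (i≢x (sym x≡i))
... | no  _   = ∉⇒∈ᵇ≡false xs i∉xs

count-∈ᵇ : ∀ {k} (P : Fin k → Bool) xs → Unique xs → count (λ i → i ∈ᵇ xs ∧ P i) ≡ countL P xs
count-∈ᵇ {k} P [] [] = trans (count≡sum {k} (λ _ → false)) (sum-replicate-zero k)
count-∈ᵇ {k} P (x ∷ xs) (x∉xs ∷ !xs) = begin
  count (λ i → (⌊ x ≟ i ⌋ ∨ i ∈ᵇ xs) ∧ P i)
    ≡⟨ count≡sum (λ i → (⌊ x ≟ i ⌋ ∨ i ∈ᵇ xs) ∧ P i) ⟩
  sum (λ i → 𝟙 ((⌊ x ≟ i ⌋ ∨ i ∈ᵇ xs) ∧ P i))
    ≡⟨ sum-cong-≗ split ⟩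
  sum (λ i → 𝟙 (atX i) + 𝟙 (inXs i))
    ≡⟨ ∑-distrib-+ (𝟙 ∘ atX) (𝟙 ∘ inXs) ⟩
  sum (𝟙 ∘ atX) + sum (𝟙 ∘ inXs)
    ≡⟨ cong₂ _+_ (sym (count≡sum atX)) (sym (count≡sum inXs)) ⟩
  count atX + count inXs
    ≡⟨ cong₂ _+_ (count-δ x P) (count-∈ᵇ P xs !xs) ⟩
  𝟙 (P x) + countL P xs ∎
  where
  open ≡-Reasoning
  atX inXs : Fin k → Bool
  atX  i = ⌊ x ≟ i ⌋ ∧ P i
  inXs i = i ∈ᵇ xs ∧ P i
  split : ∀ i → 𝟙 ((⌊ x ≟ i ⌋ ∨ i ∈ᵇ xs) ∧ P i) ≡ 𝟙 (atX i) + 𝟙 (inXs i)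
  split i with x ≟ i
  ... | no  _    = refl
  ... | yes refl rewrite ∉⇒∈ᵇ≡false xs x∉xs = sym (+-identityʳ _)

∈ᵇ-there : ∀ {k} {i : Fin k} x {xs} → i ∈ᵇ xs ≡ true → i ∈ᵇ (x ∷ xs) ≡ true
∈ᵇ-there {i = i} x i∈ with x ≟ i
... | yes _ = refl
... | no  _ = i∈

∈ᵇ-All : ∀ {k} {P : Fin k → Set} {i} xs → All P xs → i ∈ᵇ xs ≡ true → P i
∈ᵇ-All {i = i} (x ∷ xs) (Px ∷ Pxs) i∈ with x ≟ i
... | yes refl = Px
... | no  _    = ∈ᵇ-All xs Pxs i∈

distinct≤count : ∀ {k} (P : Fin k → Bool) xs → Unique xs → All (λ i → P i ≡ true) xs → length xs ≤ count P
distinct≤count P xs !xs Pxs = begin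
  length xs
    ≡⟨ sym (countL-true xs) ⟩
  countL (λ _ → true) xs
    ≡⟨ sym (count-∈ᵇ (λ _ → true) xs !xs) ⟩
  count (λ i → i ∈ᵇ xs ∧ true)
    ≤⟨ count-mono {P = λ i → i ∈ᵇ xs ∧ true} {Q = P} (λ i i∈ → ∈ᵇ-All xs Pxs (∧-conicalˡ _ _ i∈)) ⟩
  count P ∎
  where
  open ≤-Reasoning
  countL-true : ∀ ys → countL (λ (_ : Fin _) → true) ys ≡ length ys
  countL-true []       = refl
  countL-true (_ ∷ ys) = cong suc (countL-true ys)

lastOf : ∀ {A : Set} → A → List A → A
lastOf x []       = x
lastOf _ (y ∷ ys) = lastOf y ys

interior-neighbours : ∀ {k} {R : Fin k → Fin k → Set} x xs → Unique (x ∷ xs) → Linked R (x ∷ xs) →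
  ∀ {v} → v ∈ᵇ (x ∷ xs) ≡ true → x ≢ v → lastOf x xs ≢ v →
  ∃ λ y → ∃ λ w → R y v × R v w × y ≢ w × y ∈ᵇ (x ∷ xs) ≡ true × w ∈ᵇ (x ∷ xs) ≡ true
interior-neighbours x [] _ _ {v} v∈ x≢v _ with x ≟ v | v∈
... | yes x≡v | _ = ⊥-elim (x≢v x≡v)
interior-neighbours x (y ∷ ys) (x∉ ∷ !ys) (Rxy ∷ linked) {v} v∈ x≢v last≢v with x ≟ v | y ≟ v
... | yes x≡v | _ = ⊥-elim (x≢v x≡v)
interior-neighbours x (y ∷ [])     _                 _                       _ _ last≢v | no _ | yes y≡v = ⊥-elim (last≢v y≡v)
interior-neighbours x (y ∷ w ∷ ws) ((_ ∷ x≢w ∷ _) ∷ _) (Rxy ∷ Ryw ∷ _)       _ _ _      | no _ | yes refl =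
  x , w , Rxy , Ryw , x≢w , ∈-head , ∈-third
  where
  ∈-head : x ∈ᵇ (x ∷ y ∷ w ∷ ws) ≡ true
  ∈-head with x ≟ x
  ... | yes _   = refl
  ... | no  x≢x = ⊥-elim (x≢x refl)
  ∈-third : w ∈ᵇ (x ∷ y ∷ w ∷ ws) ≡ true
  ∈-third with x ≟ w | y ≟ w | w ≟ w
  ... | yes _ | _     | _       = refl
  ... | no _  | yes _ | _       = refl
  ... | no _  | no _  | yes _   = refl
  ... | no _  | no _  | no  w≢w = ⊥-elim (w≢w refl)
... | no _ | no y≢v =
  let y′ , w′ , Ry′v , Rvw′ , y′≢w′ , y′∈ , w′∈ = interior-neighbours y ys !ys linked (∈ᵇ-there y {ys} v∈) y≢v last≢v
  in y′ , w′ , Ry′v , Rvw′ , y′≢w′ , ∈ᵇ-there x {y ∷ ys} y′∈ , ∈ᵇ-there x {y ∷ ys} w′∈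


even-or-odd : ∀ n → Even n ⊎ Odd n
even-or-odd zero    = inj₁ (0 , refl)
even-or-odd (suc n) with even-or-odd n
... | inj₁ (m , n≡2m)   = inj₂ (m , cong suc n≡2m)
... | inj₂ (m , n≡1+2m) = inj₁ (suc m , trans (cong suc n≡1+2m) (sym (*-suc 2 m)))

-- Graphs

module _ (G : Graph) where
  open Graph G

  EndOf : Fin nV → Fin nE → Set
  EndOf v e = src e ≡ v ⊎ tgt e ≡ v

  incident⇒EndOf : ∀ {v e} → incident G v e ≡ true → EndOf v e
  incident⇒EndOf {v} {e} inc with src e ≟ v | tgt e ≟ v | inc
  ... | yes s≡v | _       | _ = inj₁ s≡v
  ... | no  _   | yes t≡v | _ = inj₂ t≡v

  EndOf⇒incident : ∀ {v e} → EndOf v e → incident G v e ≡ true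
  EndOf⇒incident {v} {e} end with src e ≟ v | tgt e ≟ v | end
  ... | yes _ | _     | _          = refl
  ... | no  _ | yes _ | _          = refl
  ... | no  s≢v | no _ | inj₁ s≡v = ⊥-elim (s≢v s≡v)
  ... | no  _ | no t≢v | inj₂ t≡v = ⊥-elim (t≢v t≡v)

  deg-pos : ∀ {S v} e → S e ≡ true → incident G v e ≡ true → 0 < deg G S v
  deg-pos {S} {v} e Se inc = count-pos (λ e → S e ∧ incident G v e) e (cong₂ _∧_ Se inc)

  deg-witness : ∀ {S v} → 0 < deg G S v → ∃ λ e → S e ≡ true × incident G v e ≡ true
  deg-witness {S} {v} pos =
    let e , Se∧inc = count-witness (λ e → S e ∧ incident G v e) pos
    in e , ∧-conicalˡ _ _ Se∧inc , ∧-conicalʳ _ _ Se∧inc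

  deg-mono : ∀ {S S′} → (∀ e → S e ≡ true → S′ e ≡ true) → ∀ v → deg G S v ≤ deg G S′ v
  deg-mono {S} S⊆S′ v = count-mono λ e Se∧inc →
    cong₂ _∧_ (S⊆S′ e (∧-conicalˡ _ _ Se∧inc)) (∧-conicalʳ (S e) _ Se∧inc)

  module _ (loopless : Loopless G) where

    handshake : ∀ (S : EdgeSet G) (g : Fin nV → ℕ) →
      sum (λ v → g v * deg G S v) ≡ sum (λ e → 𝟙 (S e) * (g (src e) + g (tgt e)))
    handshake S g = begin
      sum (λ v → g v * deg G S v)
        ≡⟨ sum-cong-≗ (λ v → cong (g v *_) (count≡sum (λ e → S e ∧ incident G v e))) ⟩
      sum (λ v → g v * sum (λ e → 𝟙 (S e ∧ incident G v e)))
        ≡⟨ sum-cong-≗ (λ v → *-distribˡ-sum (g v) (λ e → 𝟙 (S e ∧ incident G v e))) ⟩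
      sum (λ v → sum (λ e → g v * 𝟙 (S e ∧ incident G v e)))
        ≡⟨ ∑-comm (λ v e → g v * 𝟙 (S e ∧ incident G v e)) ⟩
      sum (λ e → sum (λ v → g v * 𝟙 (S e ∧ incident G v e)))
        ≡⟨ sum-cong-≗ at-edge ⟩
      sum (λ e → 𝟙 (S e) * (g (src e) + g (tgt e))) ∎
      where
      open ≡-Reasoning
      ends : ∀ e v → 𝟙 (incident G v e) ≡ 𝟙 ⌊ src e ≟ v ⌋ + 𝟙 ⌊ tgt e ≟ v ⌋
      ends e v with src e ≟ v | tgt e ≟ v
      ... | yes s≡v | yes t≡v = ⊥-elim (loopless e (trans s≡v (sym t≡v)))
      ... | yes _   | no  _   = refl
      ... | no  _   | yes _   = refl
      ... | no  _   | no  _   = refl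
      at-edge : ∀ e → sum (λ v → g v * 𝟙 (S e ∧ incident G v e)) ≡ 𝟙 (S e) * (g (src e) + g (tgt e))
      at-edge e with S e
      ... | false = sum-zero _ (λ v → *-zeroʳ (g v))
      ... | true  = begin
        sum (λ v → g v * 𝟙 (incident G v e))
          ≡⟨ sum-cong-≗ (λ v → cong (g v *_) (ends e v)) ⟩
        sum (λ v → g v * (𝟙 ⌊ src e ≟ v ⌋ + 𝟙 ⌊ tgt e ≟ v ⌋))
          ≡⟨ sum-cong-≗ (λ v → trans (*-distribˡ-+ (g v) (𝟙 ⌊ src e ≟ v ⌋) _) (cong₂ _+_ (*-comm (g v) _) (*-comm (g v) _))) ⟩
        sum (λ v → 𝟙 ⌊ src e ≟ v ⌋ * g v + 𝟙 ⌊ tgt e ≟ v ⌋ * g v)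
          ≡⟨ ∑-distrib-+ (λ v → 𝟙 ⌊ src e ≟ v ⌋ * g v) (λ v → 𝟙 ⌊ tgt e ≟ v ⌋ * g v) ⟩
        sum (λ v → 𝟙 ⌊ src e ≟ v ⌋ * g v) + sum (λ v → 𝟙 ⌊ tgt e ≟ v ⌋ * g v)
          ≡⟨ cong₂ _+_ (sum-δ (src e) g) (sum-δ (tgt e) g) ⟩
        g (src e) + g (tgt e)
          ≡⟨ sym (+-identityʳ _) ⟩
        1 * (g (src e) + g (tgt e)) ∎

    sum-deg : ∀ (S : EdgeSet G) → sum (deg G S) ≡ 2 * count S
    sum-deg S = begin
      sum (deg G S)
        ≡⟨ sum-cong-≗ (λ v → sym (+-identityʳ (deg G S v))) ⟩
      sum (λ v → 1 * deg G S v)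
        ≡⟨ handshake S (λ _ → 1) ⟩
      sum (λ e → 𝟙 (S e) * 2)
        ≡⟨ sum-cong-≗ (λ e → *-comm (𝟙 (S e)) 2) ⟩
      sum (λ e → 2 * 𝟙 (S e))
        ≡⟨ sym (*-distribˡ-sum 2 (𝟙 ∘ S)) ⟩
      2 * sum (𝟙 ∘ S)
        ≡⟨ cong (2 *_) (sym (count≡sum S)) ⟩
      2 * count S ∎
      where open ≡-Reasoning

  Reach-trans : ∀ {S x y w} → Reach G S x y → Reach G S y w → Reach G S x w
  Reach-trans here        q = q
  Reach-trans (fwd Se p) q = fwd Se (Reach-trans p q)
  Reach-trans (bwd Se p) q = bwd Se (Reach-trans p q)

  Reach-src⇔end : ∀ {S e v} → S e ≡ true → EndOf v e → Reach G S (src e) v × Reach G S v (src e)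
  Reach-src⇔end Se (inj₁ refl) = here , here
  Reach-src⇔end Se (inj₂ refl) = fwd Se here , bwd Se here

  module _ {S K : EdgeSet G} (comp : ComponentOf G S K) where

    component-⊆ : ∀ {e} → K e ≡ true → S e ≡ true
    component-⊆ {e} Ke = proj₁ (proj₁ (proj₂ comp e) Ke)

    component-closed : ∀ {e e′ v} → K e ≡ true → S e′ ≡ true → EndOf v e → EndOf v e′ → K e′ ≡ true
    component-closed {e} {e′} Ke Se′ v∈e v∈e′ =
      let Se , root↝e = proj₁ (proj₂ comp e) Ke
      in proj₂ (proj₂ comp e′) (Se′ , Reach-trans root↝e
           (Reach-trans (proj₁ (Reach-src⇔end Se v∈e)) (proj₂ (Reach-src⇔end Se′ v∈e′))))

  Adj-ends : ∀ {S a b} ((e , _) : Adj G S a b) → EndOf a e × EndOf b e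
  Adj-ends (_ , _ , inj₁ (s≡a , t≡b)) = inj₁ s≡a , inj₂ t≡b
  Adj-ends (_ , _ , inj₂ (s≡b , t≡a)) = inj₂ t≡a , inj₁ s≡b

  Adj-ends-satisfy : ∀ {S a b} ((e , _) : Adj G S a b) (P : Fin nV → Bool) → P a ≡ true → P b ≡ true →
    (P (src e) ∧ P (tgt e)) ≡ true
  Adj-ends-satisfy (_ , _ , inj₁ (refl , refl)) P Pa Pb rewrite Pa | Pb = refl
  Adj-ends-satisfy (_ , _ , inj₂ (refl , refl)) P Pa Pb rewrite Pa | Pb = refl

  Adj-≢ : ∀ {S a b} → Adj G S a b → Loopless G → a ≢ b
  Adj-≢ (e , _ , inj₁ (s≡a , t≡a)) loopless refl = loopless e (trans s≡a (sym t≡a))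
  Adj-≢ (e , _ , inj₂ (s≡a , t≡a)) loopless refl = loopless e (trans s≡a (sym t≡a))

  at-most-two-ends : ∀ {e a b d} → EndOf a e → EndOf b e → EndOf d e → a ≢ b → b ≢ d → a ≡ d
  at-most-two-ends (inj₁ refl) (inj₁ refl) _           a≢b _   = ⊥-elim (a≢b refl)
  at-most-two-ends (inj₂ refl) (inj₂ refl) _           a≢b _   = ⊥-elim (a≢b refl)
  at-most-two-ends (inj₁ refl) (inj₂ refl) (inj₁ refl) _   _   = refl
  at-most-two-ends (inj₁ refl) (inj₂ refl) (inj₂ refl) _   b≢d = ⊥-elim (b≢d refl)
  at-most-two-ends (inj₂ refl) (inj₁ refl) (inj₂ refl) _   _   = refl
  at-most-two-ends (inj₂ refl) (inj₁ refl) (inj₁ refl) _   b≢d = ⊥-elim (b≢d refl)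

-- Sums of flows at a single edge

FlowAt : Set
FlowAt = Bool × ℕ

at : ∀ {m} → Flow m → Fin m → FlowAt
at F e = dir F e , val F e

-- The sum of flows acts edgewise: at (F₁ ⊕ F₂) e reduces to at F₁ e ⊕ᵉ at F₂ e.
infixl 6 _⊕ᵉ_
_⊕ᵉ_ : FlowAt → FlowAt → FlowAt
(d₁ , v₁) ⊕ᵉ (d₂ , v₂) =
  (if v₂ ≤ᵇ v₁ then d₁ else d₂) , (if ⌊ d₁ Data.Bool.≟ d₂ ⌋ then v₁ + v₂ else ∣ v₁ - v₂ ∣)

at-foldl : ∀ {m k} (A : Flow m) (Fs : Fin k → Flow m) e →
  at (foldl _⊕_ A (toList Fs)) e ≡ foldl _⊕ᵉ_ (at A e) (toList (λ i → at (Fs i) e))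
at-foldl {k = zero}  A Fs e = refl
at-foldl {k = suc k} A Fs e = at-foldl (A ⊕ Fs zero) (Fs ∘ suc) e

⊕ᵉ-identityʳ : ∀ p {r} → proj₂ r ≡ 0 → p ⊕ᵉ r ≡ p
⊕ᵉ-identityʳ (d , v) {b , .0} refl with ⌊ d Data.Bool.≟ b ⌋
... | true  = cong (d ,_) (+-identityʳ v)
... | false = cong (d ,_) (∣-∣-identityʳ v)

⊕ᵉ-dir-dominant : ∀ d v b w → w ≤ v → proj₁ ((d , v) ⊕ᵉ (b , w)) ≡ d
⊕ᵉ-dir-dominant d v b w w≤v with w ≤ᵇ v in w≤ᵇv
... | true  = refl
... | false = ⊥-elim (subst T w≤ᵇv (≤⇒≤ᵇ w≤v))

⊕ᵉ-identityˡ : ∀ d v → 0 < v → (true , 0) ⊕ᵉ (d , v) ≡ (d , v)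
⊕ᵉ-identityˡ true  (suc v) _ = refl
⊕ᵉ-identityˡ false (suc v) _ = refl

foldl-⊕ᵉ-zero : ∀ {k} p (q : Fin k → FlowAt) → (∀ i → proj₂ (q i) ≡ 0) → foldl _⊕ᵉ_ p (toList q) ≡ p
foldl-⊕ᵉ-zero {zero}  p q q≡0 = refl
foldl-⊕ᵉ-zero {suc k} p q q≡0 =
  trans (cong (λ p′ → foldl _⊕ᵉ_ p′ (toList (q ∘ suc))) (⊕ᵉ-identityʳ p (q≡0 zero)))
        (foldl-⊕ᵉ-zero p (q ∘ suc) (q≡0 ∘ suc))

foldl-⊕ᵉ-single : ∀ {k} p (q : Fin k → FlowAt) i₀ → (∀ i → i ≢ i₀ → proj₂ (q i) ≡ 0) →
  foldl _⊕ᵉ_ p (toList q) ≡ p ⊕ᵉ q i₀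
foldl-⊕ᵉ-single p q zero     q≡0 = foldl-⊕ᵉ-zero (p ⊕ᵉ q zero) (q ∘ suc) (λ i → q≡0 (suc i) λ ())
foldl-⊕ᵉ-single p q (suc i₀) q≡0 =
  trans (cong (λ p′ → foldl _⊕ᵉ_ p′ (toList (q ∘ suc))) (⊕ᵉ-identityʳ p (q≡0 zero λ ())))
        (foldl-⊕ᵉ-single p (q ∘ suc) i₀ (λ i i≢i₀ → q≡0 (suc i) (i≢i₀ ∘ suc-injective)))

foldl-⊕ᵉ-dir : ∀ {k} d v (q : Fin k → FlowAt) →
  (∀ i j → proj₂ (q i) ≢ 0 → proj₂ (q j) ≢ 0 → i ≡ j) → (∀ i → proj₂ (q i) ≤ v) →
  proj₁ (foldl _⊕ᵉ_ (d , v) (toList q)) ≡ d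
foldl-⊕ᵉ-dir {zero}  d v q unique bounded = refl
foldl-⊕ᵉ-dir {suc k} d v q unique bounded = by-head-value (proj₂ (q zero)) refl
  where
  goal : Set
  goal = proj₁ (foldl _⊕ᵉ_ (d , v) (toList q)) ≡ d
  by-head-value : ∀ w → proj₂ (q zero) ≡ w → goal
  by-head-value zero    q₀≡0 =
    trans (cong (λ p′ → proj₁ (foldl _⊕ᵉ_ p′ (toList (q ∘ suc)))) (⊕ᵉ-identityʳ (d , v) q₀≡0))
          (foldl-⊕ᵉ-dir d v (q ∘ suc) (λ i j qi qj → suc-injective (unique (suc i) (suc j) qi qj)) (bounded ∘ suc))
  by-head-value (suc w) q₀≡1+w =
    trans (cong proj₁ (foldl-⊕ᵉ-zero _ (q ∘ suc) rest-zero))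
          (⊕ᵉ-dir-dominant d v (proj₁ (q zero)) _ (bounded zero))
    where
    rest-zero : ∀ i → proj₂ (q (suc i)) ≡ 0
    rest-zero i with proj₂ (q (suc i)) in qᵢ
    ... | zero  = refl
    ... | suc _ = ⊥-elim (0≢1+n (unique zero (suc i) (λ q₀≡0 → ℕ.0≢1+n (trans (sym q₀≡0) q₀≡1+w))
                                                    (λ qᵢ≡0 → ℕ.0≢1+n (trans (sym qᵢ≡0) qᵢ))))

-- Flow partitions

module FlowPartitionCounting
  (G : Graph) (loopless : Loopless G) (cubic : Cubic G)
  (F2 : EdgeSet G) (twoFactor : TwoFactor G F2)
  (black : Fin (Graph.nV G) → Bool) (FP : FlowPartition G F2 black) where

  open Graph G
  open FlowPartition FP

  M : Graph
  M = MG G t z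

  lift : Fin nE → Fin (Graph.nE M)
  lift e = e ↑ˡ (t + t)

  Sum : Flow (Graph.nE M)
  Sum = sumFlows (toList fl ++ toList fl' ++ toList fl'')

  colour-1-or-2 : EdgeSet M
  colour-1-or-2 E = (cM G t c E ≡ᵇ 1) ∨ (cM G t c E ≡ᵇ 2)

  off-F2-colour-1 : ∀ e → F2 e ≡ false → c e ≡ 1
  off-F2-colour-1 = proj₁ canon

  on-F2-colour-023 : ∀ e → F2 e ≡ true → c e ≡ 0 ⊎ c e ≡ 2 ⊎ c e ≡ 3
  on-F2-colour-023 = proj₁ (proj₂ canon)

  proper : ∀ e e′ → e ≢ e′ → (∃ λ v → incident G v e ≡ true × incident G v e′ ≡ true) → c e ≢ c e′
  proper = proj₁ (proj₂ (proj₂ canon))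

  src-lift : ∀ e → Graph.src M (lift e) ≡ src e
  src-lift e rewrite splitAt-↑ˡ nE e (t + t) = refl

  tgt-lift : ∀ e → Graph.tgt M (lift e) ≡ tgt e
  tgt-lift e rewrite splitAt-↑ˡ nE e (t + t) = refl

  incident-lift : ∀ v e → incident M v (lift e) ≡ incident G v e
  incident-lift v e rewrite src-lift e | tgt-lift e = refl

  liftE-lift : ∀ K e → liftE G t K (lift e) ≡ K e
  liftE-lift K e rewrite splitAt-↑ˡ nE e (t + t) = refl

  colour-1-or-2-lift : ∀ e → colour-1-or-2 (lift e) ≡ ((c e ≡ᵇ 1) ∨ (c e ≡ᵇ 2))
  colour-1-or-2-lift e rewrite splitAt-↑ˡ nE e (t + t) = refl

  lift≢new : ∀ e k → lift e ≢ nE ↑ʳ k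
  lift≢new e k eq with trans (sym (splitAt-↑ˡ nE e (t + t))) (trans (cong (splitAt nE) eq) (splitAt-↑ʳ nE (t + t) k))
  ... | ()

  pairSet-lift : ∀ i e → pairSet G t i (lift e) ≡ false
  pairSet-lift i e with lift e ≟ f' G i | lift e ≟ f G i
  ... | yes eq | _      = ⊥-elim (lift≢new e _ eq)
  ... | no _   | yes eq = ⊥-elim (lift≢new e _ eq)
  ... | no _   | no _   = refl

  count-lifted : ∀ (P : Fin (Graph.nE M) → Bool) → (∀ k → P (nE ↑ʳ k) ≡ false) → count P ≡ count (P ∘ lift)
  count-lifted P off-G = trans (count-↑ {nE} P)
    (trans (cong (count (P ∘ lift) +_) (count-none (P ∘ (nE ↑ʳ_)) off-G)) (+-identityʳ _))

  ZFree : Fin nV → Set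
  ZFree u = ∀ x → z x ≢ u

  new-edge-ends-z : ∀ k → (∃ λ x → Graph.src M (nE ↑ʳ k) ≡ z x) × (∃ λ x → Graph.tgt M (nE ↑ʳ k) ≡ z x)
  new-edge-ends-z k rewrite splitAt-↑ʳ nE (t + t) k with splitAt t k
  ... | inj₁ i = (inj₁ i , refl) , (inj₂ i , refl)
  ... | inj₂ i = (inj₁ i , refl) , (inj₂ i , refl)

  tailG : Bool → Fin nE → Fin nV
  tailG d e = if d then src e else tgt e

  tail-lift : ∀ F e → tail M F (lift e) ≡ tailG (dir F (lift e)) e
  tail-lift F e with dir F (lift e)
  ... | true  = src-lift e
  ... | false = tgt-lift e

  module _ {u} (u-free : ZFree u) where

    z-free-not-end : ∀ {v x} → v ≡ z x → v ≢ u
    z-free-not-end {x = x} refl = u-free x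

    outdeg-z-free : ∀ K F → outdeg M K F u ≡ count (λ e → K (lift e) ∧ ⌊ tailG (dir F (lift e)) e ≟ u ⌋)
    outdeg-z-free K F = trans (count-lifted _ new-off)
      (count-cong λ e → cong (λ w → K (lift e) ∧ ⌊ w ≟ u ⌋) (tail-lift F e))
      where
      new-off : ∀ k → (K (nE ↑ʳ k) ∧ ⌊ tail M F (nE ↑ʳ k) ≟ u ⌋) ≡ false
      new-off k with dir F (nE ↑ʳ k) | new-edge-ends-z k
      ... | true  | (_ , s≡z) , _ with Graph.src M (nE ↑ʳ k) ≟ u
      ...   | yes s≡u = ⊥-elim (z-free-not-end s≡z s≡u)
      ...   | no  _   = ∧-zeroʳ (K (nE ↑ʳ k))
      new-off k | false | _ , (_ , t≡z) with Graph.tgt M (nE ↑ʳ k) ≟ u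
      ...   | yes t≡u = ⊥-elim (z-free-not-end t≡z t≡u)
      ...   | no  _   = ∧-zeroʳ (K (nE ↑ʳ k))

    deg-z-free : ∀ K → deg M K u ≡ count (λ e → K (lift e) ∧ incident G u e)
    deg-z-free K = trans (count-lifted _ new-off)
      (count-cong λ e → cong (K (lift e) ∧_) (incident-lift u e))
      where
      new-off : ∀ k → (K (nE ↑ʳ k) ∧ incident M u (nE ↑ʳ k)) ≡ false
      new-off k with new-edge-ends-z k
      ... | (_ , s≡z) , (_ , t≡z) with Graph.src M (nE ↑ʳ k) ≟ u | Graph.tgt M (nE ↑ʳ k) ≟ u
      ...   | yes s≡u | _       = ⊥-elim (z-free-not-end s≡z s≡u)
      ...   | no  _   | yes t≡u = ⊥-elim (z-free-not-end t≡z t≡u)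
      ...   | no  _   | no  _   = ∧-zeroʳ (K (nE ↑ʳ k))

  C-component : ∀ i → ComponentOf G F2 (C i)
  C-component = proj₁ C-enum

  C-cover : ∀ e → F2 e ≡ true → ∃ λ i → C i e ≡ true
  C-cover = proj₁ (proj₂ C-enum)

  C-disjoint : ∀ {i i′ e} → C i e ≡ true → i′ ≢ i → C i′ e ≡ false
  C-disjoint {i} {i′} {e} Cie i′≢i = ¬-not λ Ci′e → i′≢i (proj₂ (proj₂ C-enum) i′ i e Ci′e Cie)

  C'-component : ∀ j → ComponentOf M colour-1-or-2 (C' j)
  C'-component = proj₁ C'-enum

  C'-cover : ∀ E → colour-1-or-2 E ≡ true → ∃ λ j → C' j E ≡ true
  C'-cover = proj₁ (proj₂ C'-enum)

  C'-unique : ∀ j j′ E → C' j E ≡ true → C' j′ E ≡ true → j ≡ j′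
  C'-unique = proj₂ (proj₂ C'-enum)

  C'-disjoint : ∀ {j j′ E} → C' j E ≡ true → j′ ≢ j → C' j′ E ≡ false
  C'-disjoint {j} {j′} {E} Cj j′≢j = ¬-not λ Cj′ → j′≢j (C'-unique j′ j E Cj′ Cj)

  fl-on : ∀ {i e} → C i e ≡ true → val (fl i) (lift e) ≡ 2
  fl-on {i} {e} Cie = proj₁ (fl-ok i) (lift e) (trans (liftE-lift (C i) e) Cie)

  fl-off : ∀ {i e} → C i e ≡ false → val (fl i) (lift e) ≡ 0
  fl-off {i} {e} Cie = proj₁ (proj₂ (fl-ok i)) (lift e) (trans (liftE-lift (C i) e) Cie)

  fl'-on : ∀ {j E} → C' j E ≡ true → val (fl' j) E ≡ 1
  fl'-on {j} {E} = proj₁ (fl'-ok j) E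

  fl'-off : ∀ {j E} → C' j E ≡ false → val (fl' j) E ≡ 0
  fl'-off {j} {E} = proj₁ (proj₂ (fl'-ok j)) E

  fl''-val : ∀ i e → val (fl'' i) (lift e) ≡ 0
  fl''-val i e = proj₁ (proj₂ (fl''-ok i)) (lift e) (pairSet-lift i e)

  at-Sum-lift : ∀ e → at Sum (lift e) ≡
    foldl _⊕ᵉ_ (foldl _⊕ᵉ_ (true , 0) (toList λ i → at (fl i) (lift e))) (toList λ j → at (fl' j) (lift e))
  at-Sum-lift e = begin
    at Sum (lift e)
      ≡⟨ cong (λ F → at F (lift e)) (trans (foldl-++ _⊕_ zeroFlow (toList fl) _) (foldl-++ _⊕_ (sumFlows (toList fl)) (toList fl') _)) ⟩
    at (foldl _⊕_ (foldl _⊕_ (sumFlows (toList fl)) (toList fl')) (toList fl'')) (lift e)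
      ≡⟨ at-foldl _ fl'' (lift e) ⟩
    foldl _⊕ᵉ_ (at (foldl _⊕_ (sumFlows (toList fl)) (toList fl')) (lift e)) (toList λ i → at (fl'' i) (lift e))
      ≡⟨ foldl-⊕ᵉ-zero _ _ (λ i → fl''-val i e) ⟩
    at (foldl _⊕_ (sumFlows (toList fl)) (toList fl')) (lift e)
      ≡⟨ at-foldl _ fl' (lift e) ⟩
    foldl _⊕ᵉ_ (at (sumFlows (toList fl)) (lift e)) (toList λ j → at (fl' j) (lift e))
      ≡⟨ cong (λ p → foldl _⊕ᵉ_ p (toList λ j → at (fl' j) (lift e))) (at-foldl zeroFlow fl (lift e)) ⟩
    foldl _⊕ᵉ_ (foldl _⊕ᵉ_ (true , 0) (toList λ i → at (fl i) (lift e))) (toList λ j → at (fl' j) (lift e)) ∎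
    where open ≡-Reasoning

  -- On a 2-factor edge the value 2 of its cycle flow outweighs the at most one value-1 summand.
  dir-Sum-F2 : ∀ {e i} → C i e ≡ true → dir Sum (lift e) ≡ dir (fl i) (lift e)
  dir-Sum-F2 {e} {i} Cie = begin
    dir Sum (lift e)
      ≡⟨ cong proj₁ (at-Sum-lift e) ⟩
    proj₁ (foldl _⊕ᵉ_ (foldl _⊕ᵉ_ (true , 0) (toList fl-at)) (toList fl'-at))
      ≡⟨ cong (λ p → proj₁ (foldl _⊕ᵉ_ p (toList fl'-at))) fl-part ⟩
    proj₁ (foldl _⊕ᵉ_ (dir (fl i) (lift e) , 2) (toList fl'-at))
      ≡⟨ foldl-⊕ᵉ-dir _ 2 fl'-at fl'-unique fl'-≤2 ⟩
    dir (fl i) (lift e) ∎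
    where
    open ≡-Reasoning
    fl-at : Fin k → FlowAt
    fl-at i′ = at (fl i′) (lift e)
    fl'-at : Fin s → FlowAt
    fl'-at j = at (fl' j) (lift e)
    fl-part : foldl _⊕ᵉ_ (true , 0) (toList fl-at) ≡ (dir (fl i) (lift e) , 2)
    fl-part = begin
      foldl _⊕ᵉ_ (true , 0) (toList fl-at)
        ≡⟨ foldl-⊕ᵉ-single _ fl-at i (λ i′ i′≢i → fl-off (C-disjoint Cie i′≢i)) ⟩
      (true , 0) ⊕ᵉ (dir (fl i) (lift e) , val (fl i) (lift e))
        ≡⟨ cong (λ v → (true , 0) ⊕ᵉ (dir (fl i) (lift e) , v)) (fl-on Cie) ⟩
      (true , 0) ⊕ᵉ (dir (fl i) (lift e) , 2)
        ≡⟨ ⊕ᵉ-identityˡ _ 2 (s≤s z≤n) ⟩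
      (dir (fl i) (lift e) , 2) ∎
    on-C' : ∀ j → val (fl' j) (lift e) ≢ 0 → C' j (lift e) ≡ true
    on-C' j val≢0 = ¬-not (val≢0 ∘ fl'-off)
    fl'-unique : ∀ j j′ → val (fl' j) (lift e) ≢ 0 → val (fl' j′) (lift e) ≢ 0 → j ≡ j′
    fl'-unique j j′ v v′ = C'-unique j j′ (lift e) (on-C' j v) (on-C' j′ v′)
    fl'-≤2 : ∀ j → val (fl' j) (lift e) ≤ 2
    fl'-≤2 j with C' j (lift e) in Cj
    ... | true  = ≤-trans (≤-reflexive (fl'-on Cj)) (s≤s z≤n)
    ... | false = ≤-trans (≤-reflexive (fl'-off Cj)) z≤n

  dir-Sum-off-F2 : ∀ {e j} → F2 e ≡ false → C' j (lift e) ≡ true → dir Sum (lift e) ≡ dir (fl' j) (lift e)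
  dir-Sum-off-F2 {e} {j} F2e Cj = begin
    dir Sum (lift e)
      ≡⟨ cong proj₁ (at-Sum-lift e) ⟩
    proj₁ (foldl _⊕ᵉ_ (foldl _⊕ᵉ_ (true , 0) (toList fl-at)) (toList fl'-at))
      ≡⟨ cong (λ p → proj₁ (foldl _⊕ᵉ_ p (toList fl'-at))) (foldl-⊕ᵉ-zero _ fl-at fl-zero) ⟩
    proj₁ (foldl _⊕ᵉ_ (true , 0) (toList fl'-at))
      ≡⟨ cong proj₁ (foldl-⊕ᵉ-single _ fl'-at j (λ j′ j′≢j → fl'-off (C'-disjoint Cj j′≢j))) ⟩
    proj₁ ((true , 0) ⊕ᵉ fl'-at j)
      ≡⟨ cong (λ v → proj₁ ((true , 0) ⊕ᵉ (dir (fl' j) (lift e) , v))) (fl'-on Cj) ⟩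
    proj₁ ((true , 0) ⊕ᵉ (dir (fl' j) (lift e) , 1))
      ≡⟨ cong proj₁ (⊕ᵉ-identityˡ _ 1 (s≤s z≤n)) ⟩
    dir (fl' j) (lift e) ∎
    where
    open ≡-Reasoning
    fl-at : Fin k → FlowAt
    fl-at i = at (fl i) (lift e)
    fl'-at : Fin s → FlowAt
    fl'-at j′ = at (fl' j′) (lift e)
    fl-zero : ∀ i → val (fl i) (lift e) ≡ 0
    fl-zero i = fl-off (¬-not (not-¬ F2e ∘ component-⊆ G (C-component i)))

  EndOf-lift : ∀ {v e} → EndOf G v e → EndOf M v (lift e)
  EndOf-lift {e = e} (inj₁ s≡v) = inj₁ (trans (src-lift e) s≡v)
  EndOf-lift {e = e} (inj₂ t≡v) = inj₂ (trans (tgt-lift e) t≡v)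

  tailG-end : ∀ d e → EndOf G (tailG d e) e
  tailG-end true  e = inj₁ refl
  tailG-end false e = inj₂ refl

  F2-colour-2 : ∀ {e} → F2 e ≡ true → colour-1-or-2 (lift e) ≡ true → c e ≡ 2
  F2-colour-2 {e} F2e in12 with on-F2-colour-023 e F2e | trans (sym (colour-1-or-2-lift e)) in12
  ... | inj₁ c≡0        | in12′ rewrite c≡0 = ⊥-elim (not-¬ refl in12′)
  ... | inj₂ (inj₁ c≡2) | _     = c≡2
  ... | inj₂ (inj₂ c≡3) | in12′ rewrite c≡3 = ⊥-elim (not-¬ refl in12′)

  black-of-weight : ∀ {v} → weight M Sum v ≡ ℤ.+ 2 → black v ≡ true
  black-of-weight {v} w≡2 with black v in bv
  ... | true  = refl
  ... | false with trans (sym (proj₂ (partition v) bv)) w≡2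
  ...   | ()

  white-of-weight : ∀ {v} → weight M Sum v ≡ ℤ.- (ℤ.+ 2) → black v ≡ false
  white-of-weight {v} w≡-2 with black v in bv
  ... | false = refl
  ... | true with trans (sym (proj₁ (partition v) bv)) w≡-2
  ...   | ()

  module Colour2Edge {e} (F2e : F2 e ≡ true) (ce≡2 : c e ≡ 2) where

    i₀ : Fin k
    i₀ = proj₁ (C-cover e F2e)

    j₀ : Fin s
    j₀ = proj₁ (C'-cover (lift e) (trans (colour-1-or-2-lift e) (cong (λ n → (n ≡ᵇ 1) ∨ (n ≡ᵇ 2)) ce≡2)))

    C-e : C i₀ e ≡ true
    C-e = proj₂ (C-cover e F2e)

    C'-e : C' j₀ (lift e) ≡ true
    C'-e = proj₂ (C'-cover (lift e) _)

    tailΣ tail′ : Fin nE → Fin nV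
    tailΣ e₀ = tailG (dir Sum (lift e₀)) e₀
    tail′ e₀ = tailG (dir (fl' j₀) (lift e₀)) e₀

    module AtEnd {u} (u∈e : EndOf G u e) where

      u-free : ZFree u
      u-free x z≡u = z-miss x e (subst (λ w → incident G w e ≡ true) (sym z≡u) (EndOf⇒incident G u∈e)) ce≡2

      Sum-outdeg-off-F2 : ℕ
      Sum-outdeg-off-F2 = count (λ e₀ → not (F2 e₀) ∧ ⌊ tailΣ e₀ ≟ u ⌋)

      Sum-outdeg-on-F2 : count (λ e₀ → F2 e₀ ∧ ⌊ tailΣ e₀ ≟ u ⌋) ≡ 1
      Sum-outdeg-on-F2 = begin
        count (λ e₀ → F2 e₀ ∧ ⌊ tailΣ e₀ ≟ u ⌋)
          ≡⟨ count-cong as-C-flow ⟩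
        count (λ e₀ → liftE G t (C i₀) (lift e₀) ∧ ⌊ tailG (dir (fl i₀) (lift e₀)) e₀ ≟ u ⌋)
          ≡⟨ sym (outdeg-z-free u-free _ (fl i₀)) ⟩
        outdeg M (liftE G t (C i₀)) (fl i₀) u
          ≡⟨ proj₂ (proj₂ (fl-ok i₀)) u u-on-C ⟩
        1 ∎
        where
        open ≡-Reasoning
        u-on-C : 0 < deg M (liftE G t (C i₀)) u
        u-on-C = deg-pos M (lift e) (trans (liftE-lift (C i₀) e) C-e) (trans (incident-lift u e) (EndOf⇒incident G u∈e))
        as-C-flow : ∀ e₀ → (F2 e₀ ∧ ⌊ tailΣ e₀ ≟ u ⌋)
                         ≡ (liftE G t (C i₀) (lift e₀) ∧ ⌊ tailG (dir (fl i₀) (lift e₀)) e₀ ≟ u ⌋)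
        as-C-flow e₀ rewrite liftE-lift (C i₀) e₀ with C i₀ e₀ in Ce₀
        ... | true rewrite component-⊆ G (C-component i₀) Ce₀ | dir-Sum-F2 Ce₀ = refl
        ... | false with F2 e₀ in F2e₀ | tailΣ e₀ ≟ u
        ...   | false | _       = refl
        ...   | true  | no _    = refl
        ...   | true  | yes t≡u = ⊥-elim (not-¬ Ce₀
                (component-closed G (C-component i₀) C-e F2e₀ u∈e (subst (λ w → EndOf G w e₀) t≡u (tailG-end _ e₀))))

      fl'-outdeg : 1 ≡ 𝟙 ⌊ tail′ e ≟ u ⌋ + Sum-outdeg-off-F2
      fl'-outdeg = begin
        1
          ≡⟨ sym (proj₂ (proj₂ (fl'-ok j₀)) u u-on-C') ⟩
        outdeg M (C' j₀) (fl' j₀) u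
          ≡⟨ outdeg-z-free u-free (C' j₀) (fl' j₀) ⟩
        count out′
          ≡⟨ count-split F2 out′ ⟩
        count (λ e₀ → F2 e₀ ∧ out′ e₀) + count (λ e₀ → not (F2 e₀) ∧ out′ e₀)
          ≡⟨ cong₂ _+_ on-F2 (count-cong off-F2) ⟩
        𝟙 ⌊ tail′ e ≟ u ⌋ + Sum-outdeg-off-F2 ∎
        where
        open ≡-Reasoning
        out′ : Fin nE → Bool
        out′ e₀ = C' j₀ (lift e₀) ∧ ⌊ tail′ e₀ ≟ u ⌋
        u-on-C' : 0 < deg M (C' j₀) u
        u-on-C' = deg-pos M (lift e) C'-e (trans (incident-lift u e) (EndOf⇒incident G u∈e))
        only-e : ∀ e₀ → (F2 e₀ ∧ out′ e₀) ≡ true → e₀ ≡ e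
        only-e e₀ on with e₀ ≟ e
        ... | yes e₀≡e = e₀≡e
        ... | no  e₀≢e = ⊥-elim (proper e₀ e e₀≢e (u , EndOf⇒incident G e₀-at-u , EndOf⇒incident G u∈e)
                                    (trans (F2-colour-2 F2e₀ (component-⊆ M (C'-component j₀) C'e₀)) (sym ce≡2)))
          where
          F2e₀ : F2 e₀ ≡ true
          F2e₀ = ∧-conicalˡ _ _ on
          C'e₀ : C' j₀ (lift e₀) ≡ true
          C'e₀ = ∧-conicalˡ _ _ (∧-conicalʳ (F2 e₀) _ on)
          e₀-at-u : EndOf G u e₀
          e₀-at-u = subst (λ w → EndOf G w e₀) (⌊⌋-witness (∧-conicalʳ (C' j₀ (lift e₀)) _ (∧-conicalʳ (F2 e₀) _ on))) (tailG-end _ e₀)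
        on-F2 : count (λ e₀ → F2 e₀ ∧ out′ e₀) ≡ 𝟙 ⌊ tail′ e ≟ u ⌋
        on-F2 rewrite count-supported (λ e₀ → F2 e₀ ∧ out′ e₀) e only-e | F2e | C'-e = refl
        off-F2 : ∀ e₀ → (not (F2 e₀) ∧ out′ e₀) ≡ (not (F2 e₀) ∧ ⌊ tailΣ e₀ ≟ u ⌋)
        off-F2 e₀ with F2 e₀ in F2e₀
        ... | true  = refl
        ... | false with C' j₀ (lift e₀) in C'e₀
        ...   | true rewrite dir-Sum-off-F2 F2e₀ C'e₀ = refl
        ...   | false with tailΣ e₀ ≟ u
        ...     | no  _   = refl
        ...     | yes t≡u = ⊥-elim (not-¬ C'e₀ (component-closed M (C'-component j₀) C'-e in12 (EndOf-lift u∈e)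
                                       (EndOf-lift (subst (λ w → EndOf G w e₀) t≡u (tailG-end _ e₀)))))
          where
          in12 : colour-1-or-2 (lift e₀) ≡ true
          in12 = trans (colour-1-or-2-lift e₀) (cong (λ n → (n ≡ᵇ 1) ∨ (n ≡ᵇ 2)) (off-F2-colour-1 e₀ F2e₀))

      Sum-outdeg : outdeg M (allEdges M) Sum u ≡ 1 + Sum-outdeg-off-F2
      Sum-outdeg = begin
        outdeg M (allEdges M) Sum u
          ≡⟨ outdeg-z-free u-free (allEdges M) Sum ⟩
        count (λ e₀ → ⌊ tailΣ e₀ ≟ u ⌋)
          ≡⟨ count-split F2 _ ⟩
        count (λ e₀ → F2 e₀ ∧ ⌊ tailΣ e₀ ≟ u ⌋) + Sum-outdeg-off-F2
          ≡⟨ cong (_+ Sum-outdeg-off-F2) Sum-outdeg-on-F2 ⟩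
        1 + Sum-outdeg-off-F2 ∎
        where open ≡-Reasoning

      M-deg : deg M (allEdges M) u ≡ 3
      M-deg = trans (deg-z-free u-free (allEdges M)) (cubic u)

      black≡not-tail : black u ≡ not ⌊ tail′ e ≟ u ⌋
      black≡not-tail with ⌊ tail′ e ≟ u ⌋ | fl'-outdeg
      ... | true  | 1≡1+out = white-of-weight (cong₂ (λ o d → ℤ.+ 2 ℤ.* ((2 * o) ℤ.⊖ d))
                                                     (trans Sum-outdeg (cong (1 +_) (+-cancelˡ-≡ 1 _ 0 (sym 1≡1+out)))) M-deg)
      ... | false | 1≡out = black-of-weight (cong₂ (λ o d → ℤ.+ 2 ℤ.* ((2 * o) ℤ.⊖ d))
                                                     (trans Sum-outdeg (cong (1 +_) (sym 1≡out))) M-deg)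

    ends-bicoloured : black (src e) ≡ not (black (tgt e))
    ends-bicoloured
      with dir (fl' j₀) (lift e) | AtEnd.black≡not-tail (inj₁ refl) | AtEnd.black≡not-tail (inj₂ refl)
    ... | true  | src-colour | tgt-colour with src e ≟ src e | src e ≟ tgt e
    ...   | no s≢s | _      = ⊥-elim (s≢s refl)
    ...   | yes _  | yes s≡t = ⊥-elim (loopless e s≡t)
    ...   | yes _  | no _   rewrite src-colour | tgt-colour = refl
    ends-bicoloured | false | src-colour | tgt-colour with tgt e ≟ src e | tgt e ≟ tgt e
    ...   | _       | no t≢t = ⊥-elim (t≢t refl)
    ...   | yes t≡s | yes _  = ⊥-elim (loopless e (sym t≡s))
    ...   | no _    | yes _  rewrite src-colour | tgt-colour = refl

  monochromatic-deg≤1 : ∀ {S n} → (∀ e → S e ≡ true → c e ≡ n) → ∀ v → deg G S v ≤ 1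
  monochromatic-deg≤1 {S} mono v = count-≤1 (λ e → S e ∧ incident G v e) at-most-one
    where
    at-most-one : ∀ e e′ → (S e ∧ incident G v e) ≡ true → (S e′ ∧ incident G v e′) ≡ true → e ≡ e′
    at-most-one e e′ on on′ with e ≟ e′
    ... | yes e≡e′ = e≡e′
    ... | no  e≢e′ = ⊥-elim (proper e e′ e≢e′ (v , ∧-conicalʳ (S e) _ on , ∧-conicalʳ (S e′) _ on′)
                                    (trans (mono e (∧-conicalˡ _ _ on)) (sym (mono e′ (∧-conicalˡ _ _ on′)))))

  module Colour2Matching
    (S : EdgeSet G) (S-F2 : ∀ e → S e ≡ true → F2 e ≡ true) (S-colour-2 : ∀ e → S e ≡ true → c e ≡ 2) where

    unmatched : Fin nV → Bool
    unmatched v = deg G S v ≡ᵇ 0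

    matched⇒¬unmatched : ∀ {v} → 0 < deg G S v → unmatched v ≡ false
    matched⇒¬unmatched {v} pos with deg G S v
    ... | suc _ = refl

    black-deg≡white-deg : sum (λ v → 𝟙 (black v) * deg G S v) ≡ sum (λ v → 𝟙 (not (black v)) * deg G S v)
    black-deg≡white-deg = trans (handshake G loopless S (𝟙 ∘ black))
      (trans (sum-cong-≗ per-edge) (sym (handshake G loopless S (𝟙 ∘ not ∘ black))))
      where
      one-each : ∀ b b′ → b ≡ not b′ → 𝟙 b + 𝟙 b′ ≡ 𝟙 (not b) + 𝟙 (not b′)
      one-each true  false _ = refl
      one-each false true  _ = refl
      per-edge : ∀ e → 𝟙 (S e) * (𝟙 (black (src e)) + 𝟙 (black (tgt e)))
                     ≡ 𝟙 (S e) * (𝟙 (not (black (src e))) + 𝟙 (not (black (tgt e))))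
      per-edge e with S e in Se
      ... | false = refl
      ... | true  = cong (1 *_) (one-each _ _ (Colour2Edge.ends-bicoloured (S-F2 e Se) (S-colour-2 e Se)))

    module _ (Q : Fin nV → Bool) (matched⇒Q : ∀ v → 0 < deg G S v → Q v ≡ true) where

      count-by-matching : ∀ (P : Fin nV → Bool) →
        count (λ v → Q v ∧ P v) ≡ sum (λ v → 𝟙 (P v) * deg G S v) + count (λ v → P v ∧ (unmatched v ∧ Q v))
      count-by-matching P = begin
        count (λ v → Q v ∧ P v)
          ≡⟨ count≡sum (λ v → Q v ∧ P v) ⟩
        sum (λ v → 𝟙 (Q v ∧ P v))
          ≡⟨ sum-cong-≗ (λ v → pointwise v (deg G S v) refl (monochromatic-deg≤1 S-colour-2 v)) ⟩
        sum (λ v → 𝟙 (P v) * deg G S v + 𝟙 (P v ∧ (unmatched v ∧ Q v)))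
          ≡⟨ ∑-distrib-+ (λ v → 𝟙 (P v) * deg G S v) _ ⟩
        sum (λ v → 𝟙 (P v) * deg G S v) + sum (λ v → 𝟙 (P v ∧ (unmatched v ∧ Q v)))
          ≡⟨ cong (sum (λ v → 𝟙 (P v) * deg G S v) +_) (sym (count≡sum (λ v → P v ∧ (unmatched v ∧ Q v)))) ⟩
        sum (λ v → 𝟙 (P v) * deg G S v) + count (λ v → P v ∧ (unmatched v ∧ Q v)) ∎
        where
        open ≡-Reasoning
        pointwise : ∀ v d → deg G S v ≡ d → d ≤ 1 → 𝟙 (Q v ∧ P v) ≡ 𝟙 (P v) * d + 𝟙 (P v ∧ (unmatched v ∧ Q v))
        pointwise v zero d≡0 _ rewrite d≡0 | *-zeroʳ (𝟙 (P v)) with Q v | P v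
        ... | true  | true  = refl
        ... | true  | false = refl
        ... | false | true  = refl
        ... | false | false = refl
        pointwise v (suc zero) d≡1 _ rewrite d≡1 | matched⇒Q v (≤-reflexive (sym d≡1)) | *-identityʳ (𝟙 (P v)) with P v
        ... | true  = refl
        ... | false = refl
        pointwise v (suc (suc _)) _ (s≤s ())

      private
        X Ub Uw : ℕ
        X  = sum (λ v → 𝟙 (not (black v)) * deg G S v)
        Ub = count (λ v → black v ∧ (unmatched v ∧ Q v))
        Uw = count (λ v → not (black v) ∧ (unmatched v ∧ Q v))

        blacks : count (λ v → Q v ∧ black v) ≡ X + Ub
        blacks = trans (count-by-matching black) (cong (_+ Ub) black-deg≡white-deg)

        whites : count (λ v → Q v ∧ not (black v)) ≡ X + Uw
        whites = count-by-matching (not ∘ black)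

        unmatcheds : count (λ v → unmatched v ∧ Q v) ≡ Ub + Uw
        unmatcheds = count-split black (λ v → unmatched v ∧ Q v)

      black≤white+unmatched :
        count (λ v → Q v ∧ black v) ≤ count (λ v → Q v ∧ not (black v)) + count (λ v → unmatched v ∧ Q v)
      black≤white+unmatched rewrite blacks | whites | unmatcheds = +-mono-≤ (m≤m+n X Uw) (m≤m+n Ub Uw)

      black≡white-if-perfect : count (λ v → unmatched v ∧ Q v) ≡ 0 →
        count (λ v → Q v ∧ black v) ≡ count (λ v → Q v ∧ not (black v))
      black≡white-if-perfect none rewrite blacks | whites =
        cong (X +_) (trans (m+n≡0⇒m≡0 Ub U≡0) (sym (m+n≡0⇒n≡0 Ub U≡0)))
        where
        U≡0 : Ub + Uw ≡ 0
        U≡0 = trans (sym unmatcheds) none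

  module OnCycle (K : EdgeSet G) (K-comp : ComponentOf G F2 K) where

    K2 K0 : EdgeSet G
    K2 e = K e ∧ (c e ≡ᵇ 2)
    K0 e = K e ∧ (c e ≡ᵇ 0)

    K2-colour-2 : ∀ e → K2 e ≡ true → c e ≡ 2
    K2-colour-2 e = ≡ᵇ-true⇒≡ ∘ ∧-conicalʳ (K e) _

    open Colour2Matching K2 (λ e → component-⊆ G K-comp ∘ ∧-conicalˡ _ _) K2-colour-2 public

    on-K-pos : ∀ {v} → onK G K v ≡ true → 0 < deg G K v
    on-K-pos {v} onv with deg G K v
    ... | suc _ = s≤s z≤n

    pos-on-K : ∀ {v} → 0 < deg G K v → onK G K v ≡ true
    pos-on-K {v} pos with deg G K v
    ... | suc _ = refl

    off-K-deg : ∀ {v} → onK G K v ≡ false → deg G K v ≡ 0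
    off-K-deg {v} offv with deg G K v
    ... | zero = refl

    on-K-all-F2 : ∀ {v e} → onK G K v ≡ true → F2 e ≡ true → incident G v e ≡ true → K e ≡ true
    on-K-all-F2 onv F2e inc =
      let e′ , Ke′ , inc′ = deg-witness G (on-K-pos onv)
      in component-closed G K-comp Ke′ F2e (incident⇒EndOf G inc′) (incident⇒EndOf G inc)

    on-K-deg : ∀ {v} → onK G K v ≡ true → deg G K v ≡ 2
    on-K-deg {v} onv = trans (count-cong as-F2) (twoFactor v)
      where
      as-F2 : ∀ e → (K e ∧ incident G v e) ≡ (F2 e ∧ incident G v e)
      as-F2 e with K e in Ke | F2 e in F2e | incident G v e in inc
      ... | true  | true  | _     = refl
      ... | true  | false | _     = ⊥-elim (not-¬ F2e (component-⊆ G K-comp Ke))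
      ... | false | true  | true  = ⊥-elim (not-¬ Ke (on-K-all-F2 onv F2e inc))
      ... | false | true  | false = refl
      ... | false | false | _     = refl

    matched⇒on-K : ∀ v → 0 < deg G K2 v → onK G K v ≡ true
    matched⇒on-K v pos = pos-on-K (≤-trans pos (deg-mono G (λ e → ∧-conicalˡ _ _) v))

    #unmatched : ℕ
    #unmatched = count (λ v → unmatched v ∧ onK G K v)

    count-on-K : count (onK G K) ≡ count K
    count-on-K = *-cancelˡ-≡ _ _ 2 (begin
      2 * count (onK G K)
        ≡⟨ cong (2 *_) (count≡sum (onK G K)) ⟩
      2 * sum (𝟙 ∘ onK G K)
        ≡⟨ *-distribˡ-sum 2 (𝟙 ∘ onK G K) ⟩
      sum (λ v → 2 * 𝟙 (onK G K v))
        ≡⟨ sum-cong-≗ twice-on ⟩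
      sum (deg G K)
        ≡⟨ sum-deg G loopless K ⟩
      2 * count K ∎)
      where
      open ≡-Reasoning
      twice-on : ∀ v → 2 * 𝟙 (onK G K v) ≡ deg G K v
      twice-on v with onK G K v in onv
      ... | true  = sym (on-K-deg onv)
      ... | false = sym (off-K-deg onv)

    #unmatched+2K2≡K : #unmatched + 2 * count K2 ≡ count K
    #unmatched+2K2≡K = begin
      #unmatched + 2 * count K2
        ≡⟨ cong₂ _+_ (count≡sum (λ v → unmatched v ∧ onK G K v)) (sym (sum-deg G loopless K2)) ⟩
      sum (λ v → 𝟙 (unmatched v ∧ onK G K v)) + sum (deg G K2)
        ≡⟨ sym (∑-distrib-+ (λ v → 𝟙 (unmatched v ∧ onK G K v)) (deg G K2)) ⟩
      sum (λ v → 𝟙 (unmatched v ∧ onK G K v) + deg G K2 v)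
        ≡⟨ sum-cong-≗ (λ v → pointwise v (deg G K2 v) refl (monochromatic-deg≤1 K2-colour-2 v)) ⟩
      sum (𝟙 ∘ onK G K)
        ≡⟨ sym (count≡sum (onK G K)) ⟩
      count (onK G K)
        ≡⟨ count-on-K ⟩
      count K ∎
      where
      open ≡-Reasoning
      pointwise : ∀ v d → deg G K2 v ≡ d → d ≤ 1 → 𝟙 (unmatched v ∧ onK G K v) + d ≡ 𝟙 (onK G K v)
      pointwise v zero          d≡0 _ rewrite d≡0 = +-identityʳ _
      pointwise v (suc zero)    d≡1 _ rewrite d≡1 | matched⇒on-K v (≤-reflexive (sym d≡1)) = refl
      pointwise v (suc (suc _)) _   (s≤s ())

    unmatched-on-K-colour-0 : ∀ {v} → unmatched v ≡ true → onK G K v ≡ true → 1 ≤ deg G K0 v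
    unmatched-on-K-colour-0 {v} unm onv = +-cancelʳ-≤ 1 1 (deg G K0 v) (begin
      2
        ≡⟨ sym (on-K-deg onv) ⟩
      deg G K v
        ≡⟨ count-split (λ e → c e ≡ᵇ 0) (λ e → K e ∧ incident G v e) ⟩
      count colour-0 + count colour-3
        ≤⟨ +-mono-≤ (≤-reflexive (count-cong as-K0)) (count-≤1 colour-3 colour-3-unique) ⟩
      deg G K0 v + 1 ∎)
      where
      open ≤-Reasoning
      colour-0 colour-3 : Fin nE → Bool
      colour-0 e = (c e ≡ᵇ 0) ∧ (K e ∧ incident G v e)
      colour-3 e = not (c e ≡ᵇ 0) ∧ (K e ∧ incident G v e)
      as-K0 : ∀ e → colour-0 e ≡ (K0 e ∧ incident G v e)
      as-K0 e with c e ≡ᵇ 0 | K e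
      ... | true  | true  = refl
      ... | true  | false = refl
      ... | false | true  = refl
      ... | false | false = refl
      is-3 : ∀ {e} → colour-3 e ≡ true → c e ≡ 3
      is-3 {e} on with on-F2-colour-023 e (component-⊆ G K-comp Ke)
        where
        Ke : K e ≡ true
        Ke = ∧-conicalˡ _ _ (∧-conicalʳ (not (c e ≡ᵇ 0)) _ on)
      ... | inj₁ c≡0 rewrite c≡0 = ⊥-elim (not-¬ refl on)
      ... | inj₂ (inj₂ c≡3) = c≡3
      ... | inj₂ (inj₁ c≡2) = ⊥-elim (not-¬ unm (matched⇒¬unmatched (deg-pos G e K2e (∧-conicalʳ (K e) _ K∧inc))))
        where
        K∧inc : (K e ∧ incident G v e) ≡ true
        K∧inc = ∧-conicalʳ (not (c e ≡ᵇ 0)) _ on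
        K2e : K2 e ≡ true
        K2e rewrite ∧-conicalˡ (K e) _ K∧inc | c≡2 = refl
      colour-3-unique : ∀ e e′ → colour-3 e ≡ true → colour-3 e′ ≡ true → e ≡ e′
      colour-3-unique e e′ on on′ with e ≟ e′
      ... | yes e≡e′ = e≡e′
      ... | no  e≢e′ = ⊥-elim (proper e e′ e≢e′ (v , at-v on , at-v on′) (trans (is-3 on) (sym (is-3 on′))))
        where
        at-v : ∀ {e} → colour-3 e ≡ true → incident G v e ≡ true
        at-v {e} on = ∧-conicalʳ (K e) _ (∧-conicalʳ (not (c e ≡ᵇ 0)) _ on)

    #unmatched≤2K0 : #unmatched ≤ 2 * count K0
    #unmatched≤2K0 = begin
      #unmatched
        ≡⟨ count≡sum (λ v → unmatched v ∧ onK G K v) ⟩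
      sum (λ v → 𝟙 (unmatched v ∧ onK G K v))
        ≤⟨ sum-mono-≤ pointwise ⟩
      sum (deg G K0)
        ≡⟨ sum-deg G loopless K0 ⟩
      2 * count K0 ∎
      where
      open ≤-Reasoning
      pointwise : ∀ v → 𝟙 (unmatched v ∧ onK G K v) ≤ deg G K0 v
      pointwise v with unmatched v in unm | onK G K v in onv
      ... | true  | true  = unmatched-on-K-colour-0 unm onv
      ... | true  | false = z≤n
      ... | false | _     = z≤n

    K0-count : (Even (count K) → count K0 ≡ 0) × (Odd (count K) → count K0 ≡ 1)
    K0-count = proj₂ (proj₂ (proj₂ canon)) K K-comp

    even-cycle-perfect : Even (count K) → #unmatched ≡ 0
    even-cycle-perfect even = n≤0⇒n≡0 (≤-trans #unmatched≤2K0 (≤-reflexive (cong (2 *_) (proj₁ K0-count even))))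

    odd-cycle-#unmatched≤1 : Odd (count K) → #unmatched ≤ 1
    odd-cycle-#unmatched≤1 odd@(m , K≡1+2m) =
      odd-≤2⇒≤1 #unmatched (≤-trans #unmatched≤2K0 (≤-reflexive (cong (2 *_) (proj₂ K0-count odd))))
                           (trans #unmatched+2K2≡K K≡1+2m)
      where
      odd-≤2⇒≤1 : ∀ x → x ≤ 2 → x + 2 * count K2 ≡ suc (2 * m) → x ≤ 1
      odd-≤2⇒≤1 zero          _ eq = ⊥-elim (even≢odd (count K2) m eq)
      odd-≤2⇒≤1 (suc zero)    _ _  = ≤-refl
      odd-≤2⇒≤1 (suc (suc zero)) _ eq = ⊥-elim (even≢odd (suc (count K2)) m (trans (*-suc 2 (count K2)) eq))
      odd-≤2⇒≤1 (suc (suc (suc _))) (s≤s (s≤s ())) _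

    #unmatched≤1 : #unmatched ≤ 1
    #unmatched≤1 with even-or-odd (count K)
    ... | inj₁ even = ≤-trans (≤-reflexive (even-cycle-perfect even)) z≤n
    ... | inj₂ odd  = odd-cycle-#unmatched≤1 odd

  cycle-balance : ∀ K → CycleOf G F2 K →
    (Even (count K) → bCyc G black K ≡ aCyc G black K) ×
    (Odd (count K) → bCyc G black K ≤ aCyc G black K + 1)
  cycle-balance K K-comp =
      (λ even → black≡white-if-perfect (onK G K) matched⇒on-K (even-cycle-perfect even))
    , (λ odd → ≤-trans (black≤white+unmatched (onK G K) matched⇒on-K)
                       (+-monoʳ-≤ (aCyc G black K) (odd-cycle-#unmatched≤1 odd)))
    where open OnCycle K K-comp

  module OnPath (x : Fin nV) (xs : List (Fin nV)) (!vs : Unique (x ∷ xs)) (linked : Linked (Adj G F2) (x ∷ xs)) where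

    vs : List (Fin nV)
    vs = x ∷ xs

    x-edge : ∃ λ e → F2 e ≡ true × incident G x e ≡ true
    x-edge = deg-witness G (subst (0 <_) (sym (twoFactor x)) (s≤s z≤n))

    K : EdgeSet G
    K = C (proj₁ (C-cover (proj₁ x-edge) (proj₁ (proj₂ x-edge))))

    module Cycle = OnCycle K (C-component _)

    path-on-K : ∀ {v} → v ∈ᵇ vs ≡ true → onK G K v ≡ true
    path-on-K = along x xs linked x-on-K
      where
      x-on-K : onK G K x ≡ true
      x-on-K = Cycle.pos-on-K (deg-pos G _ (proj₂ (C-cover _ (proj₁ (proj₂ x-edge)))) (proj₂ (proj₂ x-edge)))
      step : ∀ {a b} → Adj G F2 a b → onK G K a ≡ true → onK G K b ≡ true
      step adj@(e , F2e , _) a-on = Cycle.pos-on-K (deg-pos G e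
        (Cycle.on-K-all-F2 a-on F2e (EndOf⇒incident G (proj₁ (Adj-ends G adj))))
        (EndOf⇒incident G (proj₂ (Adj-ends G adj))))
      along : ∀ y ys → Linked (Adj G F2) (y ∷ ys) → onK G K y ≡ true → ∀ {v} → v ∈ᵇ (y ∷ ys) ≡ true → onK G K v ≡ true
      along y ys linked′ y-on {v} v∈ with y ≟ v
      ... | yes refl = y-on
      along y (y′ ∷ ys) (adj ∷ linked′) y-on v∈ | no _ = along y′ ys linked′ (step adj y-on) v∈

    KP : EdgeSet G
    KP e = (F2 e ∧ (c e ≡ᵇ 2)) ∧ (src e ∈ᵇ vs ∧ tgt e ∈ᵇ vs)

    open Colour2Matching KP (λ e → ∧-conicalˡ _ _ ∘ ∧-conicalˡ _ _)
                            (λ e → ≡ᵇ-true⇒≡ ∘ ∧-conicalʳ (F2 e) _ ∘ ∧-conicalˡ _ _) public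

    matched⇒on-path : ∀ v → 0 < deg G KP v → v ∈ᵇ vs ≡ true
    matched⇒on-path v pos with deg-witness G pos
    ... | e , KPe , inc with incident⇒EndOf G inc | ∧-conicalʳ (F2 e ∧ (c e ≡ᵇ 2)) _ KPe
    ...   | inj₁ refl | ends∈ = ∧-conicalˡ _ _ ends∈
    ...   | inj₂ refl | ends∈ = ∧-conicalʳ (src e ∈ᵇ vs) _ ends∈

    path-colour-2-edge-in-KP : ∀ {a b} (adj : Adj G F2 a b) → a ∈ᵇ vs ≡ true → b ∈ᵇ vs ≡ true →
      (c (proj₁ adj) ≡ᵇ 2) ≡ true → KP (proj₁ adj) ≡ true
    path-colour-2-edge-in-KP adj@(_ , F2e , _) a∈ b∈ c≡2 = cong₂ _∧_ (cong₂ _∧_ F2e c≡2) (Adj-ends-satisfy G adj (_∈ᵇ vs) a∈ b∈)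

    interior-colour-2-edge-in-path :
      ∀ {v y w e₂} (adj-yv : Adj G F2 y v) (adj-vw : Adj G F2 v w) → y ≢ w → y ∈ᵇ vs ≡ true → w ∈ᵇ vs ≡ true →
      v ∈ᵇ vs ≡ true → Cycle.K2 e₂ ≡ true → incident G v e₂ ≡ true → 0 < deg G KP v
    interior-colour-2-edge-in-path {v} {e₂ = e₂} adj-yv@(ey , F2ey , _) adj-vw@(ew , F2ew , _) y≢w y∈ w∈ v∈ K2e₂ inc₂
      with e₂ ≟ ey | e₂ ≟ ew
    ... | yes refl | _        = deg-pos G e₂ (path-colour-2-edge-in-KP adj-yv y∈ v∈ (∧-conicalʳ (K e₂) _ K2e₂)) inc₂
    ... | no _     | yes refl = deg-pos G e₂ (path-colour-2-edge-in-KP adj-vw v∈ w∈ (∧-conicalʳ (K e₂) _ K2e₂)) inc₂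
    ... | no e₂≢ey | no e₂≢ew with distinct≤count F2-at-v (ey ∷ ew ∷ e₂ ∷ [])
          ((ey≢ew ∷ (e₂≢ey ∘ sym) ∷ []) ∷ ((e₂≢ew ∘ sym) ∷ []) ∷ [] ∷ [])
          (cong₂ _∧_ F2ey (EndOf⇒incident G (proj₂ (Adj-ends G adj-yv)))
           ∷ cong₂ _∧_ F2ew (EndOf⇒incident G (proj₁ (Adj-ends G adj-vw)))
           ∷ cong₂ _∧_ F2e₂ inc₂ ∷ [])
      where
      F2-at-v : Fin nE → Bool
      F2-at-v e = F2 e ∧ incident G v e
      F2e₂ : F2 e₂ ≡ true
      F2e₂ = component-⊆ G (C-component _) (∧-conicalˡ _ _ K2e₂)
      ey≢ew : ey ≢ ew
      ey≢ew refl = y≢w (at-most-two-ends G (proj₁ (Adj-ends G adj-yv)) (proj₂ (Adj-ends G adj-yv))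
                         (proj₂ (Adj-ends G adj-vw)) (Adj-≢ G adj-yv loopless) (Adj-≢ G adj-vw loopless))
    ... | 3≤deg rewrite twoFactor v with 3≤deg
    ... | s≤s (s≤s ())

    interior-unmatched : ∀ {v} → v ∈ᵇ vs ≡ true → unmatched v ≡ true → x ≢ v → lastOf x xs ≢ v →
      Cycle.unmatched v ≡ true
    interior-unmatched {v} v∈ unm x≢v last≢v with deg G Cycle.K2 v in d
    ... | zero  = refl
    ... | suc _ with interior-neighbours x xs !vs linked v∈ x≢v last≢v | deg-witness G (subst (0 <_) (sym d) (s≤s z≤n))
    ...   | _ , _ , adj-yv , adj-vw , y≢w , y∈ , w∈ | _ , K2e₂ , inc₂ =
      ⊥-elim (not-¬ unm (matched⇒¬unmatched (interior-colour-2-edge-in-path adj-yv adj-vw y≢w y∈ w∈ v∈ K2e₂ inc₂)))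

    unmatched-in-path≤3 : count (λ v → unmatched v ∧ v ∈ᵇ vs) ≤ 3
    unmatched-in-path≤3 = begin
      count (λ v → unmatched v ∧ v ∈ᵇ vs)
        ≤⟨ count-mono cycle-or-end ⟩
      count (λ v → unmatched-on-K v ∨ (at-x v ∨ at-last v))
        ≤⟨ count-∨ unmatched-on-K _ ⟩
      Cycle.#unmatched + count (λ v → at-x v ∨ at-last v)
        ≤⟨ +-mono-≤ Cycle.#unmatched≤1 (count-∨ at-x at-last) ⟩
      1 + (count at-x + count at-last)
        ≡⟨ cong₂ (λ a b → 1 + (a + b)) (count-≟ x) (count-≟ (lastOf x xs)) ⟩
      3 ∎
      where
      open ≤-Reasoning
      unmatched-on-K at-x at-last : Fin nV → Bool
      unmatched-on-K v = Cycle.unmatched v ∧ onK G K v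
      at-x           v = ⌊ x ≟ v ⌋
      at-last        v = ⌊ lastOf x xs ≟ v ⌋
      cycle-or-end : ∀ v → (unmatched v ∧ v ∈ᵇ vs) ≡ true → (unmatched-on-K v ∨ (at-x v ∨ at-last v)) ≡ true
      cycle-or-end v unm∧∈ = by-ends (x ≟ v) (lastOf x xs ≟ v)
        where
        v∈ : v ∈ᵇ vs ≡ true
        v∈ = ∧-conicalʳ (unmatched v) _ unm∧∈
        by-ends : (d : Dec (x ≡ v)) (d′ : Dec (lastOf x xs ≡ v)) → (unmatched-on-K v ∨ (⌊ d ⌋ ∨ ⌊ d′ ⌋)) ≡ true
        by-ends (yes _)  _           = ∨-zeroʳ (unmatched-on-K v)
        by-ends (no _)   (yes _)     = ∨-zeroʳ (unmatched-on-K v)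
        by-ends (no x≢v) (no last≢v)
          rewrite interior-unmatched v∈ (∧-conicalˡ _ _ unm∧∈) x≢v last≢v | path-on-K v∈ = refl

  path-balance : ∀ vs → IsPath G F2 vs → bPath G black vs ≤ aPath G black vs + 3
  path-balance []       _                = z≤n
  path-balance (x ∷ xs) (!vs , linked) = begin
    countL black (x ∷ xs)
      ≡⟨ sym (count-∈ᵇ black (x ∷ xs) !vs) ⟩
    count (λ v → v ∈ᵇ vs ∧ black v)
      ≤⟨ black≤white+unmatched (_∈ᵇ vs) matched⇒on-path ⟩
    count (λ v → v ∈ᵇ vs ∧ not (black v)) + count (λ v → unmatched v ∧ v ∈ᵇ vs)
      ≤⟨ +-monoʳ-≤ _ unmatched-in-path≤3 ⟩
    count (λ v → v ∈ᵇ vs ∧ not (black v)) + 3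
      ≡⟨ cong (_+ 3) (count-∈ᵇ (not ∘ black) (x ∷ xs) !vs) ⟩
    countL (not ∘ black) (x ∷ xs) + 3 ∎
    where
    open ≤-Reasoning
    open OnPath x xs !vs linked

-- Bridgelessness only guarantees that flow partitions exist; the argument does not use it.
lemma2 : (G : Graph) → Loopless G → Cubic G → Bridgeless G →
         (F2 : EdgeSet G) → TwoFactor G F2 →
         (black : Fin (Graph.nV G) → Bool) → FlowPartition G F2 black →
         (∀ K → CycleOf G F2 K →
            (Even (count K) → bCyc G black K ≡ aCyc G black K) ×
            (Odd (count K) → bCyc G black K ≤ aCyc G black K + 1)) ×
         (∀ vs → IsPath G F2 vs → bPath G black vs ≤ aPath G black vs + 3)
lemma2 G loopless cubic _ F2 twoFactor black FP = cycle-balance , path-balance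
  where open FlowPartitionCounting G loopless cubic F2 twoFactor black FP
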